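{- Let $\mathcal B$ be a Baer subplane of $\mathrm{PG}(2,q^2)$ tangent to $\ell_\infty$ at the point $\bar T=\mathcal B\cap\ell_\infty$. For each line $m$ of $\mathcal B$ through $\bar T$ and each point $\bar P\in\ell_\infty$ with $\bar P\neq\bar T$, there is a set of $q$ $\ell_\infty$-Baer pencils with vertex $\bar P$ which partition the affine points of $\mathrm{PG}(2,q^2)$, and which partition the affine points of $\mathcal B$ into $q$ conics of $\mathcal B$ through $\bar T$, one of them degenerate. Moreover, the extension to $\mathrm{PG}(2,q^2)$ of each of these conics contains the point $\bar P$.
   Context: $q$ is a prime power and $\ell_\infty$ a fixed line of $\mathrm{PG}(2,q^2)$; affine points are points not on $\ell_\infty$. A Baer pencil is the point set covered by the $q+1$ lines joining a vertex point $P$ to the points of a Baer subline $b$ (the base). An $\ell_\infty$-Baer pencil is a Baer pencil whose vertex lies on $\ell_\infty$ and whose base meets $\ell_\infty$ in a point. A Baer subplane is tangent to $\ell_\infty$ if it meets $\ell_\infty$ in exactly one point; a line of $\mathcal B$ is a line of the subplane $\mathcal B\cong\mathrm{PG}(2,q)$, and a conic of $\mathcal B$ is a conic of this subplane, its extension being the conic of $\mathrm{PG}(2,q^2)$ with the same equation. -}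

module Defs where

open import Level using (0ℓ)
open import Data.Nat using (ℕ; zero; suc; _^_; _≥_)
open import Data.Nat.Primality using (Prime)
open import Data.Fin using (Fin)
open import Data.Product using (Σ; ∃; _×_; _,_)
open import Relation.Nullary using (¬_)
open import Relation.Binary.PropositionalEquality using (_≡_)
open import Algebra.Core using (Op₁; Op₂)
open import Algebra.Structures using (IsCommutativeRing)
open import Function.Bundles using (_↔_)

IsPrimePower : ℕ → Set
IsPrimePower q = Σ ℕ λ p → Σ ℕ λ k → Prime p × k ≥ 1 × q ≡ p ^ k

record FiniteField (n : ℕ) : Set₁ where
  infixl 6 _+_
  infixl 7 _*_
  field
    Carrier : Set
    _+_ _*_ : Op₂ Carrier
    -_      : Op₁ Carrier
    0# 1#   : Carrier
    isCommutativeRing : IsCommutativeRing _≡_ _+_ _*_ -_ 0# 1#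
    0≢1     : ¬ 0# ≡ 1#
    inverse : ∀ x → ¬ x ≡ 0# → Σ Carrier λ y → x * y ≡ 1#
    enum    : Carrier ↔ Fin n

-- Coordinates of PG(2, F) where F = GF(q^2).  Points are represented by
-- nonzero vectors of F^3 (homogeneous coordinates (x , y , z));
-- two nonzero vectors represent the same point iff they are proportional.
-- ℓ∞ is the line z = 0.
module PG (q : ℕ) {n : ℕ} (F : FiniteField n) where
  open FiniteField F public

  V3 : Set
  V3 = Carrier × Carrier × Carrier

  pow : Carrier → ℕ → Carrier
  pow x zero    = 1#
  pow x (suc k) = x * pow x k

  -- the subfield GF(q) of GF(q^2): fixed points of x ↦ x^q
  InSub : Carrier → Set
  InSub x = pow x q ≡ x

  zero3 : V3
  zero3 = 0# , 0# , 0#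

  NonZero3 : V3 → Set
  NonZero3 v = ¬ v ≡ zero3

  _·_ : Carrier → V3 → V3
  c · (x , y , z) = c * x , c * y , c * z

  _⊕_ : V3 → V3 → V3
  (x , y , z) ⊕ (x' , y' , z') = x + x' , y + y' , z + z'

  zc : V3 → Carrier
  zc (_ , _ , z) = z

  dot : V3 → V3 → Carrier
  dot (a , b , c) (x , y , z) = a * x + b * y + c * z

  det3 : V3 → V3 → V3 → Carrier
  det3 (a1 , a2 , a3) (b1 , b2 , b3) (c1 , c2 , c3) =
    a1 * (b2 * c3 + - (b3 * c2)) + - (a2 * (b1 * c3 + - (b3 * c1)))
      + a3 * (b1 * c2 + - (b2 * c1))

  Same : V3 → V3 → Set
  Same Y W = Σ Carrier λ c → ¬ c ≡ 0# × Y ≡ c · W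

  OnLinf : V3 → Set
  OnLinf v = zc v ≡ 0#

  Affine : V3 → Set
  Affine v = NonZero3 v × ¬ OnLinf v

  SubVec : V3 → Set
  SubVec (x , y , z) = InSub x × InSub y × InSub z

  NotBothZero : Carrier → Carrier → Set
  NotBothZero s t = ¬ (s ≡ 0# × t ≡ 0#)

  -- An ℓ∞-Baer pencil with vertex P.  Its base is the Baer subline
  -- b = { ⟨ s u + t v ⟩ : (s , t) ∈ GF(q)^2 ∖ 0 } on the line ⟨u , v⟩,
  -- P not on the line of b, P ∈ ℓ∞, and b meets ℓ∞ in a point.
  record LinfBaerPencil (P : V3) : Set where
    field
      u v          : V3
      vertexOnLinf : OnLinf P
      vertexOff    : ¬ det3 P u v ≡ 0#
      baseMeetsLinf : Σ Carrier λ s → Σ Carrier λ t →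
                        InSub s × InSub t × NotBothZero s t × OnLinf ((s · u) ⊕ (t · v))

  -- the point Y lies on one of the q+1 lines joining the vertex to a point of the base
  InPencil : {P : V3} → LinfBaerPencil P → V3 → Set
  InPencil {P} π Y = Σ Carrier λ s → Σ Carrier λ t → Σ Carrier λ α → Σ Carrier λ β →
    InSub s × InSub t × NotBothZero s t ×
    Y ≡ (α · P) ⊕ (β · ((s · LinfBaerPencil.u π) ⊕ (t · LinfBaerPencil.v π)))

  -- A Baer subplane: the image of the canonical PG(2,q) ⊂ PG(2,q^2) under the
  -- projectivity with (invertible) column matrix [a1 a2 a3].
  record BaerSubplane : Set where
    field
      a1 a2 a3 : V3
      invertible : ¬ det3 a1 a2 a3 ≡ 0#

  embed : BaerSubplane → V3 → V3
  embed B (x , y , z) =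
    ((x · BaerSubplane.a1 B) ⊕ (y · BaerSubplane.a2 B)) ⊕ (z · BaerSubplane.a3 B)

  InB : BaerSubplane → V3 → Set
  InB B Y = Σ V3 λ x → SubVec x × NonZero3 x × Same Y (embed B x)

  TangentAt : BaerSubplane → V3 → Set
  TangentAt B T = NonZero3 T × InB B T × OnLinf T ×
    (∀ Y → NonZero3 Y → InB B Y → OnLinf Y → Same Y T)

  -- a line of B (coordinates l ∈ GF(q)^3 ∖ 0 in B's coordinate system)
  -- passes through the point T
  LineOfBThrough : BaerSubplane → V3 → V3 → Set
  LineOfBThrough B l T = SubVec l × NonZero3 l ×
    Σ V3 λ x → SubVec x × NonZero3 x × Same T (embed B x) × dot l x ≡ 0#

  -- Conic of B: quadratic form  a x² + b y² + c z² + f y z + g z x + h x y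
  -- with coefficients in GF(q), not all zero (in B's coordinates).
  record ConicB : Set where
    field
      a b c f g h : Carrier
      coeffsSub : InSub a × InSub b × InSub c × InSub f × InSub g × InSub h
      notAllZero : ¬ (a ≡ 0# × b ≡ 0# × c ≡ 0# × f ≡ 0# × g ≡ 0# × h ≡ 0#)

  evalQ : ConicB → V3 → Carrier
  evalQ C (x , y , z) =
    a * (x * x) + b * (y * y) + c * (z * z) + f * (y * z) + g * (z * x) + h * (x * y)
    where open ConicB C

  four : Carrier
  four = 1# + 1# + 1# + 1#

  -- degenerate iff 4abc − af² − bg² − ch² + fgh = 0 (valid in every characteristic)
  Degenerate : ConicB → Set
  Degenerate C =
    four * a * b * c + - (a * (f * f)) + - (b * (g * g)) + - (c * (h * h)) + f * g * h ≡ 0#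
    where open ConicB C

  InConic : BaerSubplane → ConicB → V3 → Set
  InConic B C Y = Σ V3 λ x → SubVec x × NonZero3 x × evalQ C x ≡ 0# × Same Y (embed B x)

  -- the extension of C to PG(2,q^2) (same equation, now over GF(q^2)) contains Y
  ExtContains : BaerSubplane → ConicB → V3 → Set
  ExtContains B C Y = Σ V3 λ x → NonZero3 x × evalQ C x ≡ 0# × Same Y (embed B x)

module Submission where

open import Defs
open import Data.Nat using (ℕ; _^_)
open import Data.Fin using (Fin)
open import Data.Product using (Σ; _×_)
open import Relation.Nullary using (¬_)
open import Relation.Binary.PropositionalEquality using (_≡_)

open import Level using (0ℓ)
open import Algebra.Bundles using (CommutativeRing; CommutativeMonoid; RawRing)
import Algebra.Bundles
import Algebra.Solver.Ring.AlmostCommutativeRing as ACR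
open import Data.Nat.Base as ℕ using (zero; suc; _!)
import Data.Nat.Properties as ℕ
open import Data.Product.Base using (_,_; proj₁; proj₂)
open import Data.Product.Properties using (≡-dec)
open import Data.Maybe.Base using (Maybe; just; nothing)
open import Relation.Nullary.Decidable using (Dec; yes; no)
import Relation.Binary.PropositionalEquality as ≡
open ≡ using (_≢_; refl; cong; cong₂; sym; trans; subst)
open import Data.Nat.Divisibility using (_∣_; divides; m∣m*n; ∣1⇒≡1; ∣⇒≤)
open import Data.Nat.Primality using (Prime; euclidsLemma)
open import Data.Nat.Combinatorics using (_C_; k![n∸k]!∣n!; nCk≡n!/k![n-k]!; nCn≡1)
open import Data.Nat.DivMod using (m/n*n≡m)
open import Relation.Binary.Definitions using (DecidableEquality; tri<; tri≈; tri>)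
open import Relation.Unary using (Decidable)
import Data.Product
open import Relation.Nullary.Decidable using (via-injection)
open import Relation.Nullary.Negation using (contradiction)
open import Data.Empty using (⊥-elim)
open import Data.Sum.Base using (_⊎_; inj₁; inj₂; [_,_]′)
import Data.Fin as Fin
import Data.Fin.Properties as Fin
open import Data.Vec.Functional using (removeAt; init; last)
open import Function.Base using (_∘_; id; flip)
open import Function.Bundles using (Inverse; Injection; _↔_; mk↔ₛ′)
open import Function.Properties.Inverse using (↔⇒↣; ↔-sym; ↔-trans)
open import Algebra.Core using (Op₂)
open import Algebra.Structures using (IsCommutativeMonoid)
import Algebra.Properties.CommutativeMonoid.Sum as CommutativeMonoidSum
import Algebra.Properties.Semiring.Sum as SemiringSum
import Algebra.Properties.CommutativeSemiring.Binomial as Binomial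

-- Write x̄ = x ^ q, so that GF(q) = {x | x̄ = x} and trace x = x + x̄ maps GF(q²) onto GF(q).
-- With P = (P₁ : P₂ : 0), every affine Y lies on the line Y₃ · λ = P₂ Y₁ − P₁ Y₂ through P for a
-- unique slope λ ∈ GF(q²). For ε ∉ GF(q), δ = ε − ε̄ and e = ε / δ have trace 0 and 1, and the
-- ℓ∞-Baer pencil with vertex P and base through O + k e D and δ D (O = (0 : 0 : 1), D on ℓ∞)
-- consists of the affine points whose slope has trace k; so k ∈ GF(q) indexes a partition.
-- In the coordinates x ∈ GF(q)³ of B, let L and Φ be the forms Y₃ and P₂ Y₁ − P₁ Y₂; a point of B
-- has slope Φx / Lx, and its trace is k exactly on the conic of B
--   Q k x = (Φx)(L̄x) + (Φ̄x)(Lx) − k (Lx)(L̄x).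
-- Both forms vanish at P, so P lies on every extended conic; L and L̄ vanish at T, since by tangency
-- ℓ∞ is not a line of B. The discriminant of Q k is linear in k with nonzero slope −X X̄,
-- X = det (L, L̄, Φ), so exactly one of the conics is degenerate.

-- Algebra.Solver.Ring over an arbitrary commutative ring, with integer coefficients: the pair
-- (a , b) stands for a − b, so that terms cancelling each other are recognised by normalisation.
module IntegerCoefficients {c ℓ} (R : CommutativeRing c ℓ) where
  open CommutativeRing R hiding (zero; refl; sym; trans)
  module R = CommutativeRing R
  open import Algebra.Properties.Semiring.Mult.TCOptimised semiring
    using (1+×; ×-homo-+; ×1-homo-*) renaming (_×_ to _×′_)
  open import Algebra.Properties.Ring ring using (-0#≈0#; -‿distribˡ-*; x[y-z]≈xy-xz)
  open import Algebra.Properties.AbelianGroup +-abelianGroup using (⁻¹-anti-homo‿-; ⁻¹-∙-comm)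
  open import Algebra.Properties.CommutativeSemigroup +-commutativeSemigroup using (interchange)
  open import Relation.Binary.Reasoning.Setoid setoid

  ℤ₂ : RawRing 0ℓ 0ℓ
  ℤ₂ = record
    { Carrier = ℕ × ℕ ; _≈_ = _≡_
    ; _+_ = λ { (a , b) (c , d) → a ℕ.+ c , b ℕ.+ d }
    ; _*_ = λ { (a , b) (c , d) → a ℕ.* c ℕ.+ b ℕ.* d , a ℕ.* d ℕ.+ b ℕ.* c }
    ; -_ = λ { (a , b) → b , a }
    ; 0# = 0 , 0 ; 1# = 1 , 0 }

  reduce : ℕ × ℕ → ℕ × ℕ
  reduce (a , zero)      = a , zero
  reduce (zero , b)      = zero , b
  reduce (suc a , suc b) = reduce (a , b)

  signed : ℕ × ℕ → Carrier
  signed (a , zero)      = a ×′ 1#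
  signed (zero , b)      = - (b ×′ 1#)
  signed (suc a , suc b) = signed (a , b)

  signed-reduce : ∀ x → signed x ≡ signed (reduce x)
  signed-reduce (a , zero)      = ≡.refl
  signed-reduce (zero , suc b)  = ≡.refl
  signed-reduce (suc a , suc b) = signed-reduce (a , b)

  -+-interchange : ∀ x y z w → (x + y) - (z + w) ≈ (x - z) + (y - w)
  -+-interchange x y z w = R.trans (+-congˡ (R.sym (⁻¹-∙-comm z w))) (interchange x y (- z) (- w))

  -*-interchange : ∀ x y z w → (x - y) * (z - w) ≈ (x * z + y * w) - (x * w + y * z)
  -*-interchange x y z w = begin
    (x - y) * (z - w)                   ≈⟨ distribʳ (z - w) x (- y) ⟩
    x * (z - w) + - y * (z - w)         ≈⟨ +-cong (x[y-z]≈xy-xz x z w) (R.sym (-‿distribˡ-* y (z - w))) ⟩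
    (x * z - x * w) + - (y * (z - w))   ≈⟨ +-congˡ (-‿cong (x[y-z]≈xy-xz y z w)) ⟩
    (x * z - x * w) + - (y * z - y * w) ≈⟨ +-congˡ (⁻¹-anti-homo‿- (y * z) (y * w)) ⟩
    (x * z - x * w) + (y * w - y * z)   ≈⟨ -+-interchange (x * z) (y * w) (x * w) (y * z) ⟨
    (x * z + y * w) - (x * w + y * z)   ∎

  signed≈ : ∀ a b → signed (a , b) ≈ a ×′ 1# - b ×′ 1#
  signed≈ a       zero    = R.sym (R.trans (+-congˡ -0#≈0#) (+-identityʳ _))
  signed≈ zero    (suc b) = R.sym (+-identityˡ _)
  signed≈ (suc a) (suc b) = begin
    signed (a , b)                   ≈⟨ signed≈ a b ⟩
    a ×′ 1# - b ×′ 1#                ≈⟨ +-identityˡ _ ⟨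
    0# + (a ×′ 1# - b ×′ 1#)         ≈⟨ +-congʳ (-‿inverseʳ 1#) ⟨
    (1# - 1#) + (a ×′ 1# - b ×′ 1#)  ≈⟨ -+-interchange 1# _ 1# _ ⟨
    (1# + a ×′ 1#) - (1# + b ×′ 1#)  ≈⟨ +-cong (1+× a 1#) (-‿cong (1+× b 1#)) ⟨
    suc a ×′ 1# - suc b ×′ 1#        ∎

  homomorphism : ℤ₂ ACR.-Raw-AlmostCommutative⟶ ACR.fromCommutativeRing R
  homomorphism = record
    { ⟦_⟧ = signed
    ; +-homo = λ { (a , b) (c , d) → begin
        signed (a ℕ.+ c , b ℕ.+ d)                     ≈⟨ signed≈ (a ℕ.+ c) (b ℕ.+ d) ⟩
        (a ℕ.+ c) ×′ 1# - (b ℕ.+ d) ×′ 1#              ≈⟨ +-cong (×-homo-+ 1# a c) (-‿cong (×-homo-+ 1# b d)) ⟩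
        (a ×′ 1# + c ×′ 1#) - (b ×′ 1# + d ×′ 1#)      ≈⟨ -+-interchange _ _ _ _ ⟩
        (a ×′ 1# - b ×′ 1#) + (c ×′ 1# - d ×′ 1#)      ≈⟨ +-cong (signed≈ a b) (signed≈ c d) ⟨
        signed (a , b) + signed (c , d)                ∎ }
    ; *-homo = λ { (a , b) (c , d) → begin
        signed (a ℕ.* c ℕ.+ b ℕ.* d , a ℕ.* d ℕ.+ b ℕ.* c)   ≈⟨ signed≈ (a ℕ.* c ℕ.+ b ℕ.* d) (a ℕ.* d ℕ.+ b ℕ.* c) ⟩
        (a ℕ.* c ℕ.+ b ℕ.* d) ×′ 1# - (a ℕ.* d ℕ.+ b ℕ.* c) ×′ 1#
          ≈⟨ +-cong (R.trans (×-homo-+ 1# (a ℕ.* c) _) (+-cong (×1-homo-* a c) (×1-homo-* b d)))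
                    (-‿cong (R.trans (×-homo-+ 1# (a ℕ.* d) _) (+-cong (×1-homo-* a d) (×1-homo-* b c)))) ⟩
        (a ×′ 1# * c ×′ 1# + b ×′ 1# * d ×′ 1#) - (a ×′ 1# * d ×′ 1# + b ×′ 1# * c ×′ 1#)
          ≈⟨ -*-interchange _ _ _ _ ⟨
        (a ×′ 1# - b ×′ 1#) * (c ×′ 1# - d ×′ 1#)      ≈⟨ *-cong (signed≈ a b) (signed≈ c d) ⟨
        signed (a , b) * signed (c , d)                ∎ }
    ; -‿homo = λ { (a , b) → begin
        signed (b , a)         ≈⟨ signed≈ b a ⟩
        b ×′ 1# - a ×′ 1#      ≈⟨ ⁻¹-anti-homo‿- _ _ ⟨
        - (a ×′ 1# - b ×′ 1#)  ≈⟨ -‿cong (signed≈ a b) ⟨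
        - signed (a , b)       ∎ }
    ; 0-homo = R.refl
    ; 1-homo = R.refl
    }

  coefficient≟ : ∀ x y → Maybe (signed x ≈ signed y)
  coefficient≟ x y with ≡-dec ℕ._≟_ ℕ._≟_ (reduce x) (reduce y)
  ... | yes eq = just (reflexive (≡.trans (signed-reduce x) (≡.trans (≡.cong signed eq) (≡.sym (signed-reduce y)))))
  ... | no _ = nothing

  open import Algebra.Solver.Ring ℤ₂ (ACR.fromCommutativeRing R) homomorphism coefficient≟ public

record Enumeration {A : Set} (P : A → Set) (size : ℕ) : Set where
  field
    elem           : Fin size → A
    elem-valid     : ∀ i → P (elem i)
    elem-injective : ∀ {i j} → elem i ≡ elem j → i ≡ j
    elem-onto      : ∀ {x} → P x → Σ (Fin size) λ i → elem i ≡ x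

enumerate-Fin : ∀ {n} (P : Fin n → Set) → Decidable P → Σ ℕ (Enumeration P)
enumerate-Fin {zero}  P P? = 0 , record { elem = λ () ; elem-valid = λ () ; elem-injective = λ {i} → ⊥-elim (Fin.¬Fin0 i)
                                        ; elem-onto = λ {x} → ⊥-elim (Fin.¬Fin0 x) }
enumerate-Fin {suc n} P P? with enumerate-Fin (P ∘ Fin.suc) (P? ∘ Fin.suc) | P? Fin.zero
... | c , e | no ¬P0 = c , record
  { elem           = Fin.suc ∘ elem
  ; elem-valid     = elem-valid
  ; elem-injective = elem-injective ∘ Fin.suc-injective
  ; elem-onto      = λ { {Fin.zero} P0 → contradiction P0 ¬P0
                       ; {Fin.suc x} Px → Data.Product.map₂ (cong Fin.suc) (elem-onto Px) } }
  where open Enumeration e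
... | c , e | yes P0 = suc c , record
  { elem           = λ { Fin.zero → Fin.zero ; (Fin.suc i) → Fin.suc (elem i) }
  ; elem-valid     = λ { Fin.zero → P0 ; (Fin.suc i) → elem-valid i }
  ; elem-injective = λ { {Fin.zero} {Fin.zero} _ → refl
                       ; {Fin.suc i} {Fin.suc j} eq → cong Fin.suc (elem-injective (Fin.suc-injective eq)) }
  ; elem-onto      = λ { {Fin.zero} _ → Fin.zero , refl
                       ; {Fin.suc x} Px → Data.Product.map Fin.suc (cong Fin.suc) (elem-onto Px) } }
  where open Enumeration e

enumerate : ∀ {A : Set} {n} → A ↔ Fin n → (P : A → Set) → Decidable P → Σ ℕ (Enumeration P)
enumerate A↔Fin P P? = Data.Product.map₂ transport (enumerate-Fin (P ∘ from) (P? ∘ from))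
  where
  open Inverse A↔Fin
  transport : ∀ {c} → Enumeration (P ∘ from) c → Enumeration P c
  transport e = record
    { elem           = from ∘ elem
    ; elem-valid     = elem-valid
    ; elem-injective = elem-injective ∘ Injection.injective (↔⇒↣ (↔-sym A↔Fin))
    ; elem-onto      = λ {x} Px → Data.Product.map₂ (λ eq → trans (cong from eq) (strictlyInverseʳ x))
                                     (elem-onto (subst P (sym (strictlyInverseʳ x)) Px)) }
    where open Enumeration e

m*m≡n*n⇒m≡n : ∀ {a b} → a ℕ.* a ≡ b ℕ.* b → a ≡ b
m*m≡n*n⇒m≡n {a} {b} aa≡bb with ℕ.<-cmp a b
... | tri< a<b _ _ = contradiction aa≡bb (ℕ.<⇒≢ (ℕ.*-mono-< a<b a<b))
... | tri≈ _ a≡b _ = a≡b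
... | tri> _ _ b<a = contradiction (sym aa≡bb) (ℕ.<⇒≢ (ℕ.*-mono-< b<a b<a))

prime∣factorial⇒≤ : ∀ {p} → Prime p → ∀ m → p ∣ m ! → p ℕ.≤ m
prime∣factorial⇒≤ {p} prime-p zero p∣1 with ∣1⇒≡1 p∣1
... | refl = contradiction prime-p λ ()
prime∣factorial⇒≤ prime-p (suc m) p∣m! with euclidsLemma (suc m) (m !) prime-p p∣m!
... | inj₁ p∣1+m = ∣⇒≤ p∣1+m
... | inj₂ p∣m!  = ℕ.m≤n⇒m≤1+n (prime∣factorial⇒≤ prime-p m p∣m!)

-- p divides p! = (p C k) · k! · (p - k)!, but neither factorial when 0 < k < p.
prime∣choose : ∀ {p k} → Prime p → 0 ℕ.< k → k ℕ.< p → p ∣ p C k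
prime∣choose {p@(suc p-1)} {k} prime-p 0<k k<p
  with euclidsLemma (p C k) (k ! ℕ.* (p ℕ.∸ k) !) prime-p p∣product
  where
  p∣product : p ∣ (p C k) ℕ.* (k ! ℕ.* (p ℕ.∸ k) !)
  p∣product = subst (p ∣_) (sym (trans (cong (ℕ._* (k ! ℕ.* (p ℕ.∸ k) !)) (nCk≡n!/k![n-k]! (ℕ.<⇒≤ k<p)))
                                       (m/n*n≡m {{ℕ._!*_!≢0 k (p ℕ.∸ k)}} (k![n∸k]!∣n! (ℕ.<⇒≤ k<p)))))
                    (m∣m*n (p-1 !))
... | inj₁ p∣pCk = p∣pCk
... | inj₂ p∣k![p-k]! with euclidsLemma (k !) ((p ℕ.∸ k) !) prime-p p∣k![p-k]!
...   | inj₁ p∣k!     = contradiction (prime∣factorial⇒≤ prime-p k p∣k!) (ℕ.<⇒≱ k<p)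
...   | inj₂ p∣[p-k]! = contradiction (prime∣factorial⇒≤ prime-p _ p∣[p-k]!)
                                      (ℕ.<⇒≱ (ℕ.∸-monoʳ-< {p} {k} {0} 0<k (ℕ.<⇒≤ k<p)))

module FiniteFieldProperties {n : ℕ} (F : FiniteField n) where
  open FiniteField F public

  commutativeRing : CommutativeRing 0ℓ 0ℓ
  commutativeRing = record { isCommutativeRing = isCommutativeRing }

  open CommutativeRing commutativeRing public
    using ( _-_; +-comm; +-identityˡ; +-identityʳ; -‿inverseʳ; *-assoc; *-comm; *-identityˡ; *-identityʳ
          ; distribʳ; zeroˡ; zeroʳ; +-isCommutativeMonoid; *-isCommutativeMonoid; semiring; ring; +-abelianGroup
          ; commutativeSemiring)
  open import Algebra.Definitions.RawSemiring (Algebra.Bundles.Semiring.rawSemiring semiring) public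
    using () renaming (_×_ to _×ᶠ_; _^_ to _^ᶠ_)
  open import Algebra.Properties.Semiring.Exp semiring public using (^-assocʳ)
  open import Algebra.Properties.CommutativeSemiring.Exp commutativeSemiring public
    using (^-distrib-*)
  open import Algebra.Properties.Semiring.Mult semiring public using (×-homo-+; ×1-homo-*; ×-assoc-*; ×-congʳ)
  open import Algebra.Properties.Ring ring public using (-‿distribˡ-*; -‿distribʳ-*; -‿involutive; -0#≈0#)
  open import Algebra.Properties.AbelianGroup +-abelianGroup public using (x∙y⁻¹≈ε⇒x≈y)
  open IntegerCoefficients commutativeRing public using (solve; _:=_; con; _:+_; _:*_; _:-_; :-_; Polynomial)
  open ≡.≡-Reasoning

  _≟_ : DecidableEquality Carrier
  _≟_ = via-injection (↔⇒↣ enum) Fin._≟_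

  1≢0 : 1# ≢ 0#
  1≢0 = 0≢1 ∘ sym

  -- 0# ⁻¹ is the junk value 0#.
  _⁻¹ : Carrier → Carrier
  x ⁻¹ with x ≟ 0#
  ... | yes _   = 0#
  ... | no x≢0 = proj₁ (inverse x x≢0)

  ⁻¹-inverseʳ : ∀ {x} → x ≢ 0# → x * x ⁻¹ ≡ 1#
  ⁻¹-inverseʳ {x} x≢0 with x ≟ 0#
  ... | yes x≡0 = contradiction x≡0 x≢0
  ... | no x≢0′ = proj₂ (inverse x x≢0′)

  ⁻¹-inverseˡ : ∀ {x} → x ≢ 0# → x ⁻¹ * x ≡ 1#
  ⁻¹-inverseˡ {x} x≢0 = trans (*-comm _ x) (⁻¹-inverseʳ x≢0)

  *-cancelˡ : ∀ {x} y z → x ≢ 0# → x * y ≡ x * z → y ≡ z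
  *-cancelˡ {x} y z x≢0 xy≡xz = begin
    y                ≡⟨ *-identityˡ y ⟨
    1# * y           ≡⟨ cong (_* y) (⁻¹-inverseˡ x≢0) ⟨
    (x ⁻¹ * x) * y   ≡⟨ *-assoc _ x y ⟩
    x ⁻¹ * (x * y)   ≡⟨ cong (x ⁻¹ *_) xy≡xz ⟩
    x ⁻¹ * (x * z)   ≡⟨ *-assoc _ x z ⟨
    (x ⁻¹ * x) * z   ≡⟨ cong (_* z) (⁻¹-inverseˡ x≢0) ⟩
    1# * z           ≡⟨ *-identityˡ z ⟩
    z                ∎

  x*y≡0⇒x≡0⊎y≡0 : ∀ x y → x * y ≡ 0# → x ≡ 0# ⊎ y ≡ 0#
  x*y≡0⇒x≡0⊎y≡0 x y xy≡0 with x ≟ 0#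
  ... | yes x≡0 = inj₁ x≡0
  ... | no x≢0  = inj₂ (*-cancelˡ y 0# x≢0 (trans xy≡0 (sym (zeroʳ x))))

  *-≢0 : ∀ {x y} → x ≢ 0# → y ≢ 0# → x * y ≢ 0#
  *-≢0 {x} {y} x≢0 y≢0 = [ x≢0 , y≢0 ]′ ∘ x*y≡0⇒x≡0⊎y≡0 x y

  x*y≡0⇒y≡0 : ∀ {x y} → x ≢ 0# → x * y ≡ 0# → y ≡ 0#
  x*y≡0⇒y≡0 {x} {y} x≢0 xy≡0 = *-cancelˡ y 0# x≢0 (trans xy≡0 (sym (zeroʳ x)))

  square≡0⇒≡0 : ∀ {x} → x * x ≡ 0# → x ≡ 0#
  square≡0⇒≡0 {x} xx≡0 = [ id , id ]′ (x*y≡0⇒x≡0⊎y≡0 x x xx≡0)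

  ⁻¹-≢0 : ∀ {x} → x ≢ 0# → x ⁻¹ ≢ 0#
  ⁻¹-≢0 {x} x≢0 x⁻¹≡0 = 1≢0 (trans (sym (⁻¹-inverseʳ x≢0)) (trans (cong (x *_) x⁻¹≡0) (zeroʳ x)))

  x+y≡z⇒y≡z-x : ∀ {x y z} → x + y ≡ z → y ≡ z - x
  x+y≡z⇒y≡z-x {x} {y} x+y≡z = trans (solve 2 (λ x y → y := (x :+ y) :- x) refl x y) (cong (_- x) x+y≡z)

  x-y≡0⇒x≡y : ∀ {x y} → x - y ≡ 0# → x ≡ y
  x-y≡0⇒x≡y = x∙y⁻¹≈ε⇒x≈y _ _

  x≢y⇒x-y≢0 : ∀ {x y} → x ≢ y → x - y ≢ 0#
  x≢y⇒x-y≢0 x≢y = x≢y ∘ x-y≡0⇒x≡y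

  0⁻¹≡0 : 0# ⁻¹ ≡ 0#
  0⁻¹≡0 with 0# ≟ 0#
  ... | yes _   = refl
  ... | no 0≢0 = contradiction refl 0≢0

  ⁻¹-unique : ∀ {x y} → x * y ≡ 1# → x ⁻¹ ≡ y
  ⁻¹-unique {x} {y} xy≡1 = *-cancelˡ (x ⁻¹) y x≢0 (trans (⁻¹-inverseʳ x≢0) (sym xy≡1))
    where
    x≢0 : x ≢ 0#
    x≢0 x≡0 = 1≢0 (trans (sym xy≡1) (trans (cong (_* y) x≡0) (zeroˡ y)))

  ‿⁻¹ : ∀ {y} → y ≢ 0# → (- y) ⁻¹ ≡ - (y ⁻¹)
  ‿⁻¹ {y} y≢0 = ⁻¹-unique (trans (solve 2 (λ y y′ → (:- y) :* (:- y′) := y :* y′) refl y (y ⁻¹)) (⁻¹-inverseʳ y≢0))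

  infixl 7 _/_
  _/_ : Carrier → Carrier → Carrier
  x / y = x * y ⁻¹

  /-*-cancel : ∀ {x y} → y ≢ 0# → (x / y) * y ≡ x
  /-*-cancel {x} {y} y≢0 = trans (*-assoc x _ y) (trans (cong (x *_) (⁻¹-inverseˡ y≢0)) (*-identityʳ x))

  ‿/‿ : ∀ {x y} → y ≢ 0# → (- x) / (- y) ≡ x / y
  ‿/‿ {x} {y} y≢0 = trans (cong ((- x) *_) (‿⁻¹ y≢0)) (solve 2 (λ x y′ → (:- x) :* (:- y′) := x :* y′) refl x (y ⁻¹))

  x≡z*y⇒x/y≡z : ∀ {x y z} → y ≢ 0# → x ≡ z * y → x / y ≡ z
  x≡z*y⇒x/y≡z {y = y} {z} y≢0 x≡zy =
    trans (cong (_* y ⁻¹) x≡zy) (trans (*-assoc z y _) (trans (cong (z *_) (⁻¹-inverseʳ y≢0)) (*-identityʳ z)))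

  ^-≢0 : ∀ {x} k → x ≢ 0# → x ^ᶠ k ≢ 0#
  ^-≢0 zero    x≢0 = 1≢0
  ^-≢0 (suc k) x≢0 = *-≢0 x≢0 (^-≢0 k x≢0)

  ^≡0⇒≡0 : ∀ {x} k → x ^ᶠ k ≡ 0# → x ≡ 0#
  ^≡0⇒≡0 {x} k xᵏ≡0 with x ≟ 0#
  ... | yes x≡0 = x≡0
  ... | no x≢0  = contradiction xᵏ≡0 (^-≢0 k x≢0)

  element : Fin n → Carrier
  element = Inverse.from enum

  module FieldSum {_∙_ : Op₂ Carrier} {ε : Carrier} (isCM : IsCommutativeMonoid _≡_ _∙_ ε) where
    monoid : CommutativeMonoid 0ℓ 0ℓ
    monoid = record { isCommutativeMonoid = isCM }

    open CommutativeMonoidSum monoid public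

    sum-reindex : (τ : Carrier ↔ Carrier) (f : Carrier → Carrier) →
                  sum (f ∘ element) ≡ sum (f ∘ Inverse.to τ ∘ element)
    sum-reindex τ f = trans (sum-permute (f ∘ element) (↔-trans (↔-sym enum) (↔-trans τ enum)))
                            (sum-cong-≗ {n} (λ i → cong f (Inverse.strictlyInverseʳ enum _)))

  module ∑ = FieldSum +-isCommutativeMonoid
  module ∏ = FieldSum *-isCommutativeMonoid

  translation : Carrier → Carrier ↔ Carrier
  translation c = mk↔ₛ′ (_+ c) (_- c)
    (λ y → solve 2 (λ y c → (y :- c) :+ c := y) refl y c)
    (λ y → solve 2 (λ y c → (y :+ c) :- c := y) refl y c)

  scaling : ∀ {c} → c ≢ 0# → Carrier ↔ Carrier
  scaling {c} c≢0 = mk↔ₛ′ (c *_) (c ⁻¹ *_)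
    (λ y → trans (sym (*-assoc c _ y)) (trans (cong (_* y) (⁻¹-inverseʳ c≢0)) (*-identityˡ y)))
    (λ y → trans (sym (*-assoc _ c y)) (trans (cong (_* y) (⁻¹-inverseˡ c≢0)) (*-identityˡ y)))

  -- Translating by 1 permutes the field, so the sum S of all elements satisfies S = S + n · 1.
  characteristic : n ×ᶠ 1# ≡ 0#
  characteristic = begin
    n ×ᶠ 1#              ≡⟨ solve 2 (λ s c → c := (s :+ c) :- s) refl S (n ×ᶠ 1#) ⟩
    (S + n ×ᶠ 1#) - S    ≡⟨ cong (_- S) shift ⟨
    S - S                ≡⟨ -‿inverseʳ S ⟩
    0#                   ∎
    where
    S = ∑.sum element
    shift : S ≡ S + n ×ᶠ 1#
    shift = begin
      S                               ≡⟨ ∑.sum-reindex (translation 1#) id ⟩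
      ∑.sum (λ i → element i + 1#)    ≡⟨ ∑.∑-distrib-+ element (λ _ → 1#) ⟩
      S + ∑.sum {n} (λ _ → 1#)        ≡⟨ cong (S +_) (∑.sum-replicate n) ⟩
      S + n ×ᶠ 1#                     ∎

  ifZero : Carrier → Carrier → Carrier → Carrier
  ifZero y a b with y ≟ 0#
  ... | yes _ = a
  ... | no _  = b

  ifZero-yes : ∀ {y} a b → y ≡ 0# → ifZero y a b ≡ a
  ifZero-yes {y} a b y≡0 with y ≟ 0#
  ... | yes _   = refl
  ... | no y≢0 = contradiction y≡0 y≢0

  ifZero-no : ∀ {y} a b → y ≢ 0# → ifZero y a b ≡ b
  ifZero-no {y} a b y≢0 with y ≟ 0#
  ... | yes y≡0 = contradiction y≡0 y≢0
  ... | no _    = refl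

  ∏-≢0 : ∀ {m} (t : Fin m → Carrier) → (∀ i → t i ≢ 0#) → ∏.sum t ≢ 0#
  ∏-≢0 {zero}  t tᵢ≢0 = 1≢0
  ∏-≢0 {suc m} t tᵢ≢0 = *-≢0 (tᵢ≢0 Fin.zero) (∏-≢0 (t ∘ Fin.suc) (tᵢ≢0 ∘ Fin.suc))

  ∏-except-one : ∀ {m} (t : Fin m → Carrier) i {a} → t i ≡ 1# → (∀ j → j ≢ i → t j ≡ a) →
                 a ^ᶠ m ≡ a * ∏.sum t
  ∏-except-one {suc m} t i {a} tᵢ≡1 tⱼ≡a = cong (a *_) (begin
    a ^ᶠ m                       ≡⟨ ∏.sum-replicate m ⟨
    ∏.sum {m} (λ _ → a)          ≡⟨ *-identityˡ _ ⟨
    1# * ∏.sum {m} (λ _ → a)     ≡⟨ cong₂ _*_ tᵢ≡1 (∏.sum-cong-≗ {m} (λ j → tⱼ≡a _ (Fin.punchInᵢ≢i i j))) ⟨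
    t i * ∏.sum (removeAt t i)   ≡⟨ ∏.sum-remove {i = i} t ⟨
    ∏.sum t                      ∎)

  0^ᶠ≡0 : ∀ {m} → m ≢ 0 → 0# ^ᶠ m ≡ 0#
  0^ᶠ≡0 {zero}  m≢0 = contradiction refl m≢0
  0^ᶠ≡0 {suc m} _   = zeroˡ _

  n≢0 : n ≢ 0
  n≢0 n≡0 = Fin.¬Fin0 (subst Fin n≡0 (Inverse.to enum 0#))

  -- Multiplying by x permutes the field; comparing the products of the nonzero elements
  -- before and after gives x ^ (n - 1) = 1.
  fermat : ∀ x → x ^ᶠ n ≡ x
  fermat x with x ≟ 0#
  ... | yes refl = 0^ᶠ≡0 n≢0
  ... | no x≢0   = begin
    x ^ᶠ n            ≡⟨ ∏-except-one (λ i → ifZero (element i) 1# x) (Inverse.to enum 0#)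
                           (ifZero-yes 1# x (Inverse.strictlyInverseʳ enum 0#))
                           (λ j j≢0 → ifZero-no 1# x (j≢0 ∘ zero-index j)) ⟩
    x * Factors     ≡⟨ cong (x *_) Factors≡1 ⟩
    x * 1#            ≡⟨ *-identityʳ x ⟩
    x                 ∎
    where
    unit : Carrier → Carrier
    unit y = ifZero y 1# y
    Units Factors : Carrier
    Units = ∏.sum (unit ∘ element)
    Factors = ∏.sum (λ i → ifZero (element i) 1# x)

    zero-index : ∀ j → element j ≡ 0# → j ≡ Inverse.to enum 0#
    zero-index j eⱼ≡0 = trans (sym (Inverse.strictlyInverseˡ enum j)) (cong (Inverse.to enum) eⱼ≡0)

    unit-* : ∀ y → unit (x * y) ≡ ifZero y 1# x * unit y
    unit-* y with y ≟ 0#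
    ... | yes y≡0 = trans (ifZero-yes 1# _ (trans (cong (x *_) y≡0) (zeroʳ x))) (sym (*-identityˡ 1#))
    ... | no y≢0  = ifZero-no 1# _ (*-≢0 x≢0 y≢0)

    unit-≢0 : ∀ y → unit y ≢ 0#
    unit-≢0 y with y ≟ 0#
    ... | yes _   = 1≢0
    ... | no y≢0 = y≢0

    Factors≡1 : Factors ≡ 1#
    Factors≡1 = *-cancelˡ Factors 1# (∏-≢0 (unit ∘ element) (unit-≢0 ∘ element)) (begin
      Units * Factors   ≡⟨ *-comm Units Factors ⟩
      Factors * Units   ≡⟨ ∏.∑-distrib-+ (λ i → ifZero (element i) 1# x) (unit ∘ element) ⟨
      ∏.sum (λ i → ifZero (element i) 1# x * unit (element i))  ≡⟨ ∏.sum-cong-≗ {n} (unit-* ∘ element) ⟨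
      ∏.sum (unit ∘ (x *_) ∘ element)                            ≡⟨ ∏.sum-reindex (scaling x≢0) unit ⟨
      Units               ≡⟨ *-identityʳ Units ⟨
      Units * 1#          ∎)

  ∣⇒×ᶠ≡0 : ∀ {p} → p ×ᶠ 1# ≡ 0# → ∀ {m} z → p ∣ m → m ×ᶠ z ≡ 0#
  ∣⇒×ᶠ≡0 {p} p≡0 z (divides c refl) = begin
    (c ℕ.* p) ×ᶠ z                  ≡⟨ ×-congʳ (c ℕ.* p) (*-identityˡ z) ⟨
    (c ℕ.* p) ×ᶠ (1# * z)           ≡⟨ ×-assoc-* (c ℕ.* p) 1# z ⟨
    ((c ℕ.* p) ×ᶠ 1#) * z           ≡⟨ cong (_* z) (×1-homo-* c p) ⟩
    ((c ×ᶠ 1#) * (p ×ᶠ 1#)) * z     ≡⟨ cong (λ u → ((c ×ᶠ 1#) * u) * z) p≡0 ⟩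
    ((c ×ᶠ 1#) * 0#) * z            ≡⟨ cong (_* z) (zeroʳ _) ⟩
    0# * z                          ≡⟨ zeroˡ z ⟩
    0#                              ∎

  module ∑ₛ = SemiringSum semiring

  ∑-first-last : ∀ {m} (t : Fin (suc (suc m)) → Carrier) → (∀ i → t (Fin.suc (Fin.inject₁ i)) ≡ 0#) →
                 ∑ₛ.sum t ≡ t Fin.zero + t (Fin.fromℕ (suc m))
  ∑-first-last {m} t middle≡0 = cong (t Fin.zero +_) (begin
    ∑ₛ.sum (t ∘ Fin.suc)                              ≡⟨ ∑ₛ.sum-init-last (t ∘ Fin.suc) ⟩
    ∑ₛ.sum (init (t ∘ Fin.suc)) + last (t ∘ Fin.suc)   ≡⟨ cong (_+ last (t ∘ Fin.suc)) (∑ₛ.sum-cong-≗ {m} middle≡0) ⟩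
    ∑ₛ.sum {m} (λ _ → 0#) + last (t ∘ Fin.suc)         ≡⟨ cong (_+ last (t ∘ Fin.suc)) (∑ₛ.sum-replicate-zero m) ⟩
    0# + last (t ∘ Fin.suc)                           ≡⟨ +-identityˡ _ ⟩
    t (Fin.fromℕ (suc m))                             ∎)

  -- The inner binomial coefficients of (x + y) ^ p are divisible by p.
  frobenius : ∀ {p} → Prime p → p ×ᶠ 1# ≡ 0# → ∀ x y → (x + y) ^ᶠ p ≡ x ^ᶠ p + y ^ᶠ p
  frobenius {0}     p-prime = contradiction p-prime λ ()
  frobenius {1}     p-prime = contradiction p-prime λ ()
  frobenius {p@(suc (suc m))} p-prime p≡0 x y = begin
    (x + y) ^ᶠ p                                        ≡⟨ theorem p x y ⟩
    binomialExpansion x y p                             ≡⟨ ∑-first-last (binomialTerm x y p) inner≡0 ⟩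
    binomialTerm x y p Fin.zero + binomialTerm x y p (Fin.fromℕ p)
                                                        ≡⟨ cong₂ _+_ first (trans (term≡ (Fin.toℕ-fromℕ p)) top) ⟩
    y ^ᶠ p + x ^ᶠ p                                     ≡⟨ +-comm _ _ ⟩
    x ^ᶠ p + y ^ᶠ p                                     ∎
    where
    open Binomial commutativeSemiring using (theorem; binomialExpansion; binomialTerm)
    term≡ : ∀ {k j} → Fin.toℕ {suc p} k ≡ j → binomialTerm x y p k ≡ (p C j) ×ᶠ (x ^ᶠ j * y ^ᶠ (p ℕ.∸ j))
    term≡ = cong (λ j → (p C j) ×ᶠ (x ^ᶠ j * y ^ᶠ (p ℕ.∸ j)))
    first : binomialTerm x y p Fin.zero ≡ y ^ᶠ p
    first = trans (+-identityʳ _) (*-identityˡ _)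
    top : (p C p) ×ᶠ (x ^ᶠ p * y ^ᶠ (p ℕ.∸ p)) ≡ x ^ᶠ p
    top = begin
      (p C p) ×ᶠ (x ^ᶠ p * y ^ᶠ (p ℕ.∸ p))  ≡⟨ cong₂ (λ c e → c ×ᶠ (x ^ᶠ p * y ^ᶠ e)) (nCn≡1 p) (ℕ.n∸n≡0 p) ⟩
      1 ×ᶠ (x ^ᶠ p * 1#)                    ≡⟨ +-identityʳ _ ⟩
      x ^ᶠ p * 1#                           ≡⟨ *-identityʳ _ ⟩
      x ^ᶠ p                                ∎
    inner≡0 : ∀ i → binomialTerm x y p (Fin.suc (Fin.inject₁ i)) ≡ 0#
    inner≡0 i = ∣⇒×ᶠ≡0 p≡0 _ (prime∣choose p-prime (ℕ.s≤s ℕ.z≤n) (ℕ.s≤s (Fin.inject₁ℕ< i)))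

module Subfield (q : ℕ) (q-pp : IsPrimePower q) (F : FiniteField (q ^ 2)) where
  open FiniteFieldProperties F public
  open PG q F public using (pow; InSub)
  open ≡.≡-Reasoning

  conj : Carrier → Carrier
  conj x = pow x q

  pow≡^ᶠ : ∀ x k → pow x k ≡ x ^ᶠ k
  pow≡^ᶠ x zero    = refl
  pow≡^ᶠ x (suc k) = cong (x *_) (pow≡^ᶠ x k)

  private
    p = proj₁ q-pp
    k = proj₁ (proj₂ q-pp)
    p-prime : Prime p
    p-prime = proj₁ (proj₂ (proj₂ q-pp))
    q≡pᵏ : q ≡ p ^ k
    q≡pᵏ = proj₂ (proj₂ (proj₂ (proj₂ q-pp)))

  ×ᶠ1-^ : ∀ m j → (m ^ j) ×ᶠ 1# ≡ (m ×ᶠ 1#) ^ᶠ j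
  ×ᶠ1-^ m zero    = +-identityʳ 1#
  ×ᶠ1-^ m (suc j) = trans (×1-homo-* m (m ^ j)) (cong ((m ×ᶠ 1#) *_) (×ᶠ1-^ m j))

  p×ᶠ1≡0 : p ×ᶠ 1# ≡ 0#
  p×ᶠ1≡0 = ^≡0⇒≡0 k (begin
    (p ×ᶠ 1#) ^ᶠ k    ≡⟨ ×ᶠ1-^ p k ⟨
    (p ^ k) ×ᶠ 1#     ≡⟨ cong (_×ᶠ 1#) q≡pᵏ ⟨
    q ×ᶠ 1#           ≡⟨ ^≡0⇒≡0 2 (trans (sym (×ᶠ1-^ q 2)) characteristic) ⟩
    0#                ∎)

  frobenius-^ : ∀ j x y → (x + y) ^ᶠ (p ^ j) ≡ x ^ᶠ (p ^ j) + y ^ᶠ (p ^ j)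
  frobenius-^ zero    x y = trans (*-identityʳ _) (cong₂ _+_ (sym (*-identityʳ x)) (sym (*-identityʳ y)))
  frobenius-^ (suc j) x y = begin
    (x + y) ^ᶠ (p ℕ.* p ^ j)                    ≡⟨ ^-assocʳ (x + y) p (p ^ j) ⟨
    ((x + y) ^ᶠ p) ^ᶠ (p ^ j)                    ≡⟨ cong (_^ᶠ (p ^ j)) (frobenius p-prime p×ᶠ1≡0 x y) ⟩
    (x ^ᶠ p + y ^ᶠ p) ^ᶠ (p ^ j)                 ≡⟨ frobenius-^ j (x ^ᶠ p) (y ^ᶠ p) ⟩
    (x ^ᶠ p) ^ᶠ (p ^ j) + (y ^ᶠ p) ^ᶠ (p ^ j)     ≡⟨ cong₂ _+_ (^-assocʳ x p (p ^ j)) (^-assocʳ y p (p ^ j)) ⟩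
    x ^ᶠ (p ℕ.* p ^ j) + y ^ᶠ (p ℕ.* p ^ j)      ∎

  conj-+ : ∀ x y → conj (x + y) ≡ conj x + conj y
  conj-+ x y = begin
    pow (x + y) q            ≡⟨ pow≡^ᶠ (x + y) q ⟩
    (x + y) ^ᶠ q             ≡⟨ subst (λ m → (x + y) ^ᶠ m ≡ x ^ᶠ m + y ^ᶠ m) (sym q≡pᵏ) (frobenius-^ k x y) ⟩
    x ^ᶠ q + y ^ᶠ q          ≡⟨ cong₂ _+_ (pow≡^ᶠ x q) (pow≡^ᶠ y q) ⟨
    pow x q + pow y q        ∎

  conj-* : ∀ x y → conj (x * y) ≡ conj x * conj y
  conj-* x y = trans (pow≡^ᶠ (x * y) q)
    (trans (^-distrib-* x y q) (sym (cong₂ _*_ (pow≡^ᶠ x q) (pow≡^ᶠ y q))))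

  conj-involutive : ∀ x → conj (conj x) ≡ x
  conj-involutive x = begin
    pow (pow x q) q          ≡⟨ trans (pow≡^ᶠ _ q) (cong (_^ᶠ q) (pow≡^ᶠ x q)) ⟩
    (x ^ᶠ q) ^ᶠ q            ≡⟨ ^-assocʳ x q q ⟩
    x ^ᶠ (q ℕ.* q)           ≡⟨ cong (x ^ᶠ_) (cong (q ℕ.*_) (ℕ.*-identityʳ q)) ⟨
    x ^ᶠ (q ^ 2)             ≡⟨ fermat x ⟩
    x                        ∎

  conj-injective : ∀ {x y} → conj x ≡ conj y → x ≡ y
  conj-injective {x} {y} eq = trans (sym (conj-involutive x)) (trans (cong conj eq) (conj-involutive y))

  conj-0 : conj 0# ≡ 0#
  conj-0 = trans (pow≡^ᶠ 0# q) (0^ᶠ≡0 q≢0)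
    where
    q≢0 : q ≢ 0
    q≢0 q≡0 = contradiction (subst Prime (ℕ.m^n≡0⇒m≡0 p k (trans (sym q≡pᵏ) q≡0)) p-prime) λ ()

  conj-1 : conj 1# ≡ 1#
  conj-1 = trans (pow≡^ᶠ 1# q) (^ᶠ-1 q)
    where
    ^ᶠ-1 : ∀ m → 1# ^ᶠ m ≡ 1#
    ^ᶠ-1 zero    = refl
    ^ᶠ-1 (suc m) = trans (*-identityˡ _) (^ᶠ-1 m)

  conj-‿ : ∀ x → conj (- x) ≡ - conj x
  conj-‿ x = begin
    conj (- x)                       ≡⟨ solve 2 (λ a b → b := :- a :+ (a :+ b)) refl (conj x) (conj (- x)) ⟩
    - conj x + (conj x + conj (- x)) ≡⟨ cong (- conj x +_) (conj-+ x (- x)) ⟨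
    - conj x + conj (x - x)          ≡⟨ cong (λ u → - conj x + conj u) (-‿inverseʳ x) ⟩
    - conj x + conj 0#               ≡⟨ cong (- conj x +_) conj-0 ⟩
    - conj x + 0#                    ≡⟨ +-identityʳ _ ⟩
    - conj x                         ∎

  conj-- : ∀ x y → conj (x - y) ≡ conj x - conj y
  conj-- x y = trans (conj-+ x (- y)) (cong (conj x +_) (conj-‿ y))

  conj-≢0 : ∀ {x} → x ≢ 0# → conj x ≢ 0#
  conj-≢0 x≢0 = x≢0 ∘ conj-injective ∘ flip trans (sym conj-0)

  conj-⁻¹ : ∀ x → conj (x ⁻¹) ≡ conj x ⁻¹
  conj-⁻¹ x = by-cases (x ≟ 0#)
    where
    by-cases : Dec (x ≡ 0#) → conj (x ⁻¹) ≡ conj x ⁻¹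
    by-cases (yes x≡0) = subst (λ y → conj (y ⁻¹) ≡ conj y ⁻¹) (sym x≡0)
      (trans (cong conj 0⁻¹≡0) (trans conj-0 (trans (sym 0⁻¹≡0) (cong _⁻¹ (sym conj-0)))))
    by-cases (no x≢0)  = sym (⁻¹-unique (trans (sym (conj-* x (x ⁻¹))) (trans (cong conj (⁻¹-inverseʳ x≢0)) conj-1)))

  conj-/ : ∀ x y → conj (x / y) ≡ conj x / conj y
  conj-/ x y = trans (conj-* x (y ⁻¹)) (cong (conj x *_) (conj-⁻¹ y))

  InSub? : ∀ x → Dec (InSub x)
  InSub? x = conj x ≟ x

  trace : Carrier → Carrier
  trace x = x + conj x

  tr₂ : Carrier → Carrier → Carrier
  tr₂ u v = u * conj v + conj u * v

  InSub-0 : InSub 0#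
  InSub-0 = conj-0

  InSub-1 : InSub 1#
  InSub-1 = conj-1

  InSub-+ : ∀ {x y} → InSub x → InSub y → InSub (x + y)
  InSub-+ {x} {y} x∈ y∈ = trans (conj-+ x y) (cong₂ _+_ x∈ y∈)

  InSub-* : ∀ {x y} → InSub x → InSub y → InSub (x * y)
  InSub-* {x} {y} x∈ y∈ = trans (conj-* x y) (cong₂ _*_ x∈ y∈)

  InSub-‿ : ∀ {x} → InSub x → InSub (- x)
  InSub-‿ {x} x∈ = trans (conj-‿ x) (cong -_ x∈)

  InSub-- : ∀ {x y} → InSub x → InSub y → InSub (x - y)
  InSub-- x∈ y∈ = InSub-+ x∈ (InSub-‿ y∈)

  InSub-/ : ∀ {x y} → InSub x → InSub y → InSub (x / y)
  InSub-/ {x} {y} x∈ y∈ = trans (conj-/ x y) (cong₂ _/_ x∈ y∈)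

  InSub-trace : ∀ x → InSub (trace x)
  InSub-trace x = trans (conj-+ x (conj x)) (trans (cong (conj x +_) (conj-involutive x)) (+-comm _ _))

  InSub-tr₂ : ∀ u v → InSub (tr₂ u v)
  InSub-tr₂ u v = trans (conj-+ _ _) (trans (cong₂ _+_ (trans (conj-* u (conj v)) (cong (conj u *_) (conj-involutive v)))
                                                      (trans (conj-* (conj u) v) (cong (_* conj v) (conj-involutive u))))
                                            (+-comm _ _))

  norm≡0⇒≡0 : ∀ {x} → conj x * x ≡ 0# → x ≡ 0#
  norm≡0⇒≡0 {x} N≡0 with x ≟ 0#
  ... | yes x≡0 = x≡0
  ... | no x≢0  = contradiction N≡0 (*-≢0 (conj-≢0 x≢0) x≢0)

  InSub-norm : ∀ x → InSub (x * conj x)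
  InSub-norm x = trans (conj-* x (conj x)) (trans (cong (conj x *_) (conj-involutive x)) (*-comm _ _))

  conj-antisymmetric : ∀ x → conj (x - conj x) ≡ - (x - conj x)
  conj-antisymmetric x = begin
    conj (x - conj x)       ≡⟨ conj-- x (conj x) ⟩
    conj x - conj (conj x)  ≡⟨ cong (λ u → conj x - u) (conj-involutive x) ⟩
    conj x - x              ≡⟨ solve 2 (λ x x̄ → x̄ :- x := :- (x :- x̄)) refl x (conj x) ⟩
    - (x - conj x)          ∎

  InSub-/-antiInvariant : ∀ {z w} → conj z ≡ - z → conj w ≡ - w → w ≢ 0# → InSub (z / w)
  InSub-/-antiInvariant {z} {w} z̄≡-z w̄≡-w w≢0 =
    trans (conj-/ z w) (trans (cong₂ _/_ z̄≡-z w̄≡-w) (‿/‿ w≢0))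

  -- With ε ∉ GF(q), every x is uniquely re x + im x · ε with re x, im x ∈ GF(q).
  module Coordinates {ε} (ε∉ : ¬ InSub ε) where
    δ : Carrier
    δ = ε - conj ε

    δ≢0 : δ ≢ 0#
    δ≢0 = x≢y⇒x-y≢0 (ε∉ ∘ sym)

    im re : Carrier → Carrier
    im x = (x - conj x) / δ
    re x = x - im x * ε

    -- Abstract, so that the index of re x in an enumeration never unfolds these proofs.
    abstract
      InSub-im : ∀ x → InSub (im x)
      InSub-im x = InSub-/-antiInvariant (conj-antisymmetric x) (conj-antisymmetric ε) δ≢0

      InSub-re : ∀ x → InSub (re x)
      InSub-re x = begin
        conj (x - im x * ε)
          ≡⟨ trans (conj-- x _) (cong (λ u → conj x - u) (trans (conj-* (im x) ε) (cong (_* conj ε) (InSub-im x)))) ⟩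
        conj x - im x * conj ε
          ≡⟨ solve 5 (λ x x̄ i ε ε̄ → x̄ :- i :* ε̄ := (x :- i :* ε) :- ((x :- x̄) :- i :* (ε :- ε̄))) refl x (conj x) (im x) ε (conj ε) ⟩
        (x - im x * ε) - ((x - conj x) - im x * δ)
          ≡⟨ cong (λ u → (x - im x * ε) - ((x - conj x) - u)) (/-*-cancel δ≢0) ⟩
        (x - im x * ε) - ((x - conj x) - (x - conj x))
          ≡⟨ solve 2 (λ a d → a :- (d :- d) := a) refl (x - im x * ε) (x - conj x) ⟩
        x - im x * ε
          ∎

    re+im : ∀ x → x ≡ re x + im x * ε
    re+im x = solve 2 (λ x y → x := (x :- y) :+ y) refl x (im x * ε)

    coordinates-unique : ∀ {a b a′ b′} → InSub a → InSub b → InSub a′ → InSub b′ →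
                         a + b * ε ≡ a′ + b′ * ε → a ≡ a′ × b ≡ b′
    coordinates-unique {a} {b} {a′} {b′} a∈ b∈ a′∈ b′∈ eq = by-cases (b ≟ b′)
      where
      a-a′≡ : a - a′ ≡ (b′ - b) * ε
      a-a′≡ = begin
        a - a′                                          ≡⟨ solve 5 (λ a a′ b b′ ε → a :- a′ := ((a :+ b :* ε) :- (a′ :+ b′ :* ε)) :+ (b′ :- b) :* ε)
                                                             refl a a′ b b′ ε ⟩
        ((a + b * ε) - (a′ + b′ * ε)) + (b′ - b) * ε     ≡⟨ cong (λ u → (u - (a′ + b′ * ε)) + (b′ - b) * ε) eq ⟩
        ((a′ + b′ * ε) - (a′ + b′ * ε)) + (b′ - b) * ε   ≡⟨ solve 2 (λ u v → (u :- u) :+ v := v) refl (a′ + b′ * ε) ((b′ - b) * ε) ⟩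
        (b′ - b) * ε                                    ∎

      by-cases : Dec (b ≡ b′) → a ≡ a′ × b ≡ b′
      by-cases (yes b≡b′) = x-y≡0⇒x≡y (trans a-a′≡ (trans (cong (λ u → (b′ - u) * ε) b≡b′)
                              (trans (cong (_* ε) (-‿inverseʳ b′)) (zeroˡ ε)))) , b≡b′
      by-cases (no b≢b′)  = contradiction (subst InSub ε≡ (InSub-/ (InSub-- a∈ a′∈) (InSub-- b′∈ b∈))) ε∉
        where
        ε≡ : (a - a′) / (b′ - b) ≡ ε
        ε≡ = x≡z*y⇒x/y≡z (x≢y⇒x-y≢0 (b≢b′ ∘ sym)) (trans a-a′≡ (*-comm _ ε))

    -- (i , j) ↦ elem i + elem j · ε and x ↦ (re x , im x) are injections between GF(q²) and GF(q) × GF(q).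
    module Counting {c} (e : Enumeration InSub c) where
      open Enumeration e

      pack : Fin (c ℕ.* c) → Fin (q ^ 2)
      pack ij = Inverse.to enum (elem (proj₁ (Fin.remQuot {c} c ij)) + elem (proj₂ (Fin.remQuot {c} c ij)) * ε)

      re-index im-index : Carrier → Fin c
      re-index x = proj₁ (elem-onto (InSub-re x))
      im-index x = proj₁ (elem-onto (InSub-im x))

      elem-re-index : ∀ x → elem (re-index x) ≡ re x
      elem-re-index x = proj₂ (elem-onto (InSub-re x))

      elem-im-index : ∀ x → elem (im-index x) ≡ im x
      elem-im-index x = proj₂ (elem-onto (InSub-im x))

      unpack : Fin (q ^ 2) → Fin (c ℕ.* c)
      unpack i = Fin.combine (re-index (element i)) (im-index (element i))

      pack-injective : ∀ {ij kl} → pack ij ≡ pack kl → ij ≡ kl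
      pack-injective {ij} {kl} eq = begin
        ij                                   ≡⟨ Fin.combine-remQuot {c} c ij ⟨
        Fin.combine (proj₁ i,j) (proj₂ i,j)  ≡⟨ cong₂ Fin.combine (elem-injective (proj₁ same)) (elem-injective (proj₂ same)) ⟩
        Fin.combine (proj₁ k,l) (proj₂ k,l)  ≡⟨ Fin.combine-remQuot {c} c kl ⟩
        kl                                   ∎
        where
        i,j = Fin.remQuot {c} c ij
        k,l = Fin.remQuot {c} c kl
        same = coordinates-unique (elem-valid _) (elem-valid _) (elem-valid _) (elem-valid _)
                 (Injection.injective (↔⇒↣ enum) eq)

      unpack-injective : ∀ {i j} → unpack i ≡ unpack j → i ≡ j
      unpack-injective {i} {j} eq = Injection.injective (↔⇒↣ (↔-sym enum)) (begin
        element i                               ≡⟨ re+im (element i) ⟩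
        re (element i) + im (element i) * ε     ≡⟨ cong₂ (λ a b → a + b * ε) (via elem-re-index (proj₁ indices))
                                                                           (via elem-im-index (proj₂ indices)) ⟩
        re (element j) + im (element j) * ε     ≡⟨ re+im (element j) ⟨
        element j                               ∎)
        where
        indices : re-index (element i) ≡ re-index (element j) × im-index (element i) ≡ im-index (element j)
        indices = Fin.combine-injective _ _ _ _ eq
        via : ∀ {ind : Carrier → Fin c} {f : Carrier → Carrier} → (∀ x → elem (ind x) ≡ f x) →
              ind (element i) ≡ ind (element j) → f (element i) ≡ f (element j)
        via elem-ind eq′ = trans (sym (elem-ind (element i))) (trans (cong elem eq′) (elem-ind (element j)))

    enumeration-size : ∀ {c} → Enumeration InSub c → c ≡ q
    enumeration-size e = m*m≡n*n⇒m≡n (trans (Fin.cantor-schröder-bernstein {f = pack} {g = unpack} pack-injective unpack-injective)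
                                            (cong (q ℕ.*_) (ℕ.*-identityʳ q)))
      where open Counting e

    subfield : Enumeration InSub q
    subfield = subst (Enumeration InSub) (enumeration-size (proj₂ e)) (proj₂ e)
      where e = enumerate enum InSub (λ x → conj x ≟ x)

-- Vector algebra in F³ for any finite field F; q only selects the instance of PG.
module Vectors (q : ℕ) {n : ℕ} (F : FiniteField n) where
  open FiniteFieldProperties F
  open PG q F using (V3; zero3; NonZero3; _·_; _⊕_; zc; dot; det3)
  open ≡.≡-Reasoning

  V3-≡ : ∀ {a b c a′ b′ c′ : Carrier} → a ≡ a′ → b ≡ b′ → c ≡ c′ → (a , b , c) ≡ (a′ , b′ , c′)
  V3-≡ refl refl refl = refl

  cross : V3 → V3 → V3
  cross (u₁ , u₂ , u₃) (v₁ , v₂ , v₃) = u₂ * v₃ - u₃ * v₂ , u₃ * v₁ - u₁ * v₃ , u₁ * v₂ - u₂ * v₁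

  infixl 20 _⊖_
  _⊖_ : V3 → V3 → V3
  (x , y , z) ⊖ (x′ , y′ , z′) = x - x′ , y - y′ , z - z′

  linear : V3 → V3 → V3 → V3 → V3
  linear a b c (x , y , z) = ((x · a) ⊕ (y · b)) ⊕ (z · c)

  adjugate : V3 → V3 → V3 → V3 → V3
  adjugate a b c y = dot (cross b c) y , dot (cross c a) y , dot (cross a b) y

  _≟V_ : DecidableEquality V3
  _≟V_ = ≡-dec _≟_ (≡-dec _≟_ _≟_)

  -- The same operations on solver expressions, to state coordinate identities in vector form.
  module Formal {m : ℕ} where
    Vₚ : Set
    Vₚ = Polynomial m × Polynomial m × Polynomial m

    _·ₚ_ : Polynomial m → Vₚ → Vₚ
    c ·ₚ (x , y , z) = c :* x , c :* y , c :* z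

    _⊕ₚ_ : Vₚ → Vₚ → Vₚ
    (x , y , z) ⊕ₚ (x′ , y′ , z′) = x :+ x′ , y :+ y′ , z :+ z′

    dotₚ : Vₚ → Vₚ → Polynomial m
    dotₚ (a , b , c) (x , y , z) = a :* x :+ b :* y :+ c :* z

    crossₚ : Vₚ → Vₚ → Vₚ
    crossₚ (u₁ , u₂ , u₃) (v₁ , v₂ , v₃) = u₂ :* v₃ :- u₃ :* v₂ , u₃ :* v₁ :- u₁ :* v₃ , u₁ :* v₂ :- u₂ :* v₁

    det3ₚ : Vₚ → Vₚ → Vₚ → Polynomial m
    det3ₚ (a₁ , a₂ , a₃) (b₁ , b₂ , b₃) (c₁ , c₂ , c₃) =
      a₁ :* (b₂ :* c₃ :+ :- (b₃ :* c₂)) :+ :- (a₂ :* (b₁ :* c₃ :+ :- (b₃ :* c₁)))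
        :+ a₃ :* (b₁ :* c₂ :+ :- (b₂ :* c₁))

    0ₚ 1ₚ : Polynomial m
    0ₚ = con (0 , 0)
    1ₚ = con (1 , 0)

    quadraticₚ : (a b c f g h : Polynomial m) → Vₚ → Polynomial m
    quadraticₚ a b c f g h (x , y , z) = a :* (x :* x) :+ b :* (y :* y) :+ c :* (z :* z) :+ f :* (y :* z) :+ g :* (z :* x) :+ h :* (x :* y)

    zcₚ : Vₚ → Polynomial m
    zcₚ (_ , _ , z) = z

    linearₚ : Vₚ → Vₚ → Vₚ → Vₚ → Vₚ
    linearₚ a b c (x , y , z) = ((x ·ₚ a) ⊕ₚ (y ·ₚ b)) ⊕ₚ (z ·ₚ c)

    adjugateₚ : Vₚ → Vₚ → Vₚ → Vₚ → Vₚ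
    adjugateₚ a b c y = dotₚ (crossₚ b c) y , dotₚ (crossₚ c a) y , dotₚ (crossₚ a b) y

  open Formal

  ·-assoc : ∀ a b v → a · (b · v) ≡ (a * b) · v
  ·-assoc a b (v₁ , v₂ , v₃) = V3-≡ (sym (*-assoc a b v₁)) (sym (*-assoc a b v₂)) (sym (*-assoc a b v₃))

  ·-identity : ∀ v → 1# · v ≡ v
  ·-identity (v₁ , v₂ , v₃) = V3-≡ (*-identityˡ v₁) (*-identityˡ v₂) (*-identityˡ v₃)

  ·-zeroˡ : ∀ v → 0# · v ≡ zero3
  ·-zeroˡ (v₁ , v₂ , v₃) = V3-≡ (zeroˡ v₁) (zeroˡ v₂) (zeroˡ v₃)

  ·-zeroʳ : ∀ c → c · zero3 ≡ zero3
  ·-zeroʳ c = V3-≡ (zeroʳ c) (zeroʳ c) (zeroʳ c)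

  ·-cancel : ∀ {c} u v → c ≢ 0# → c · u ≡ c · v → u ≡ v
  ·-cancel (u₁ , u₂ , u₃) (v₁ , v₂ , v₃) c≢0 eq =
    V3-≡ (*-cancelˡ u₁ v₁ c≢0 (cong proj₁ eq)) (*-cancelˡ u₂ v₂ c≢0 (cong (proj₁ ∘ proj₂) eq))
         (*-cancelˡ u₃ v₃ c≢0 (cong (proj₂ ∘ proj₂) eq))

  ·-solve : ∀ {c u v} → c ≢ 0# → u ≡ c · v → v ≡ (c ⁻¹) · u
  ·-solve {c} {u} {v} c≢0 u≡cv = begin
    v                 ≡⟨ ·-identity v ⟨
    1# · v            ≡⟨ cong (_· v) (⁻¹-inverseˡ c≢0) ⟨
    (c ⁻¹ * c) · v    ≡⟨ ·-assoc (c ⁻¹) c v ⟨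
    (c ⁻¹) · (c · v)  ≡⟨ cong ((c ⁻¹) ·_) u≡cv ⟨
    (c ⁻¹) · u        ∎

  ⊖-⊕ : ∀ u v → (u ⊖ v) ⊕ v ≡ u
  ⊖-⊕ (u₁ , u₂ , u₃) (v₁ , v₂ , v₃) = V3-≡ (cancel u₁ v₁) (cancel u₂ v₂) (cancel u₃ v₃)
    where
    cancel : ∀ a b → (a - b) + b ≡ a
    cancel = solve 2 (λ a b → (a :- b) :+ b := a) refl

  dot-comm : ∀ u v → dot u v ≡ dot v u
  dot-comm (u₁ , u₂ , u₃) (v₁ , v₂ , v₃) =
    solve 6 (λ u₁ u₂ u₃ v₁ v₂ v₃ → dotₚ (u₁ , u₂ , u₃) (v₁ , v₂ , v₃) := dotₚ (v₁ , v₂ , v₃) (u₁ , u₂ , u₃))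
      refl u₁ u₂ u₃ v₁ v₂ v₃

  dot-⊕ : ∀ u v w → dot u (v ⊕ w) ≡ dot u v + dot u w
  dot-⊕ (u₁ , u₂ , u₃) (v₁ , v₂ , v₃) (w₁ , w₂ , w₃) =
    solve 9 (λ u₁ u₂ u₃ v₁ v₂ v₃ w₁ w₂ w₃ → let u = u₁ , u₂ , u₃ ; v = v₁ , v₂ , v₃ ; w = w₁ , w₂ , w₃ in
               dotₚ u (v ⊕ₚ w) := dotₚ u v :+ dotₚ u w) refl u₁ u₂ u₃ v₁ v₂ v₃ w₁ w₂ w₃

  dot-⊖ : ∀ u v w → dot u (v ⊖ w) ≡ dot u v - dot u w
  dot-⊖ (u₁ , u₂ , u₃) (v₁ , v₂ , v₃) (w₁ , w₂ , w₃) =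
    solve 9 (λ u₁ u₂ u₃ v₁ v₂ v₃ w₁ w₂ w₃ → let u = u₁ , u₂ , u₃ ; w = w₁ , w₂ , w₃ in
               dotₚ u (v₁ :- w₁ , v₂ :- w₂ , v₃ :- w₃) := dotₚ u (v₁ , v₂ , v₃) :- dotₚ u w) refl u₁ u₂ u₃ v₁ v₂ v₃ w₁ w₂ w₃

  dot-· : ∀ u c v → dot u (c · v) ≡ c * dot u v
  dot-· (u₁ , u₂ , u₃) c (v₁ , v₂ , v₃) =
    solve 7 (λ u₁ u₂ u₃ c v₁ v₂ v₃ → let u = u₁ , u₂ , u₃ ; v = v₁ , v₂ , v₃ in dotₚ u (c ·ₚ v) := c :* dotₚ u v)
      refl u₁ u₂ u₃ c v₁ v₂ v₃

  dot-linear : ∀ a b c u x → dot u (linear a b c x) ≡ dot (dot u a , dot u b , dot u c) x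
  dot-linear (a₁ , a₂ , a₃) (b₁ , b₂ , b₃) (c₁ , c₂ , c₃) (u₁ , u₂ , u₃) (x₁ , x₂ , x₃) =
    solve 15 (λ a₁ a₂ a₃ b₁ b₂ b₃ c₁ c₂ c₃ u₁ u₂ u₃ x₁ x₂ x₃ →
                let a = a₁ , a₂ , a₃ ; b = b₁ , b₂ , b₃ ; c = c₁ , c₂ , c₃ ; u = u₁ , u₂ , u₃ ; x = x₁ , x₂ , x₃ in
                dotₚ u (linearₚ a b c x) := dotₚ (dotₚ u a , dotₚ u b , dotₚ u c) x)
      refl a₁ a₂ a₃ b₁ b₂ b₃ c₁ c₂ c₃ u₁ u₂ u₃ x₁ x₂ x₃

  zc-linear : ∀ a b c x → zc (linear a b c x) ≡ dot (zc a , zc b , zc c) x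
  zc-linear (a₁ , a₂ , a₃) (b₁ , b₂ , b₃) (c₁ , c₂ , c₃) (x₁ , x₂ , x₃) =
    solve 12 (λ a₁ a₂ a₃ b₁ b₂ b₃ c₁ c₂ c₃ x₁ x₂ x₃ → let a = a₁ , a₂ , a₃ ; b = b₁ , b₂ , b₃ ; c = c₁ , c₂ , c₃ in
                zcₚ (linearₚ a b c (x₁ , x₂ , x₃)) := dotₚ (zcₚ a , zcₚ b , zcₚ c) (x₁ , x₂ , x₃))
      refl a₁ a₂ a₃ b₁ b₂ b₃ c₁ c₂ c₃ x₁ x₂ x₃


  cross-·-self : ∀ c v → cross (c · v) v ≡ zero3
  cross-·-self c (v₁ , v₂ , v₃) = V3-≡ (vanish v₂ v₃) (vanish v₃ v₁) (vanish v₁ v₂)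
    where
    vanish : ∀ a b → (c * a) * b - (c * b) * a ≡ 0#
    vanish a b = solve 3 (λ c a b → (c :* a) :* b :- (c :* b) :* a := 0ₚ) refl c a b

  cross-self : ∀ v → cross v v ≡ zero3
  cross-self v = trans (cong (λ u → cross u v) (sym (·-identity v))) (cross-·-self 1# v)
  cross-zeroˡ : ∀ v → cross zero3 v ≡ zero3
  cross-zeroˡ v = trans (cong (λ u → cross u v) (sym (·-zeroˡ v))) (cross-·-self 0# v)

  cross-zeroʳ : ∀ u → cross u zero3 ≡ zero3
  cross-zeroʳ (u₁ , u₂ , u₃) = V3-≡ (vanish u₂ u₃) (vanish u₃ u₁) (vanish u₁ u₂)
    where
    vanish : ∀ a b → a * 0# - b * 0# ≡ 0#
    vanish = solve 2 (λ a b → a :* 0ₚ :- b :* 0ₚ := 0ₚ) refl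

  dot-cross-scaled : ∀ c u v → dot u (cross (c · u) v) ≡ 0#
  dot-cross-scaled c (u₁ , u₂ , u₃) (v₁ , v₂ , v₃) =
    solve 7 (λ c u₁ u₂ u₃ v₁ v₂ v₃ → let u = u₁ , u₂ , u₃ in dotₚ u (crossₚ (c ·ₚ u) (v₁ , v₂ , v₃)) := 0ₚ)
      refl c u₁ u₂ u₃ v₁ v₂ v₃

  cross-cross : ∀ u v w → cross u (cross v w) ≡ (dot u w · v) ⊕ ((- dot u v) · w)
  cross-cross (u₁ , u₂ , u₃) (v₁ , v₂ , v₃) (w₁ , w₂ , w₃) = V3-≡
    (solve 9 (λ u₁ u₂ u₃ v₁ v₂ v₃ w₁ w₂ w₃ → let u = u₁ , u₂ , u₃ ; v = v₁ , v₂ , v₃ ; w = w₁ , w₂ , w₃ in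
       proj₁ (crossₚ u (crossₚ v w)) := proj₁ ((dotₚ u w ·ₚ v) ⊕ₚ ((:- dotₚ u v) ·ₚ w))) refl u₁ u₂ u₃ v₁ v₂ v₃ w₁ w₂ w₃)
    (solve 9 (λ u₁ u₂ u₃ v₁ v₂ v₃ w₁ w₂ w₃ → let u = u₁ , u₂ , u₃ ; v = v₁ , v₂ , v₃ ; w = w₁ , w₂ , w₃ in
       proj₁ (proj₂ (crossₚ u (crossₚ v w))) := proj₁ (proj₂ ((dotₚ u w ·ₚ v) ⊕ₚ ((:- dotₚ u v) ·ₚ w)))) refl u₁ u₂ u₃ v₁ v₂ v₃ w₁ w₂ w₃)
    (solve 9 (λ u₁ u₂ u₃ v₁ v₂ v₃ w₁ w₂ w₃ → let u = u₁ , u₂ , u₃ ; v = v₁ , v₂ , v₃ ; w = w₁ , w₂ , w₃ in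
       proj₂ (proj₂ (crossₚ u (crossₚ v w))) := proj₂ (proj₂ ((dotₚ u w ·ₚ v) ⊕ₚ ((:- dotₚ u v) ·ₚ w)))) refl u₁ u₂ u₃ v₁ v₂ v₃ w₁ w₂ w₃)

  cross-cross≡0 : ∀ u v w → dot u v ≡ 0# → dot u w ≡ 0# → cross u (cross v w) ≡ zero3
  cross-cross≡0 u v@(v₁ , v₂ , v₃) w@(w₁ , w₂ , w₃) u·v≡0 u·w≡0 = begin
    cross u (cross v w)                          ≡⟨ cross-cross u v w ⟩
    (dot u w · v) ⊕ ((- dot u v) · w)            ≡⟨ cong₂ (λ a b → (a · v) ⊕ ((- b) · w)) u·w≡0 u·v≡0 ⟩
    (0# · v) ⊕ ((- 0#) · w)                      ≡⟨ V3-≡ (vanish v₁ w₁) (vanish v₂ w₂) (vanish v₃ w₃) ⟩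
    zero3                                        ∎
    where
    vanish : ∀ a b → 0# * a + (- 0#) * b ≡ 0#
    vanish = solve 2 (λ a b → 0ₚ :* a :+ (:- 0ₚ) :* b := 0ₚ) refl

  cross-of-crosses : ∀ s e f → cross (cross s e) (cross s f) ≡ det3 s e f · s
  cross-of-crosses (s₁ , s₂ , s₃) (e₁ , e₂ , e₃) (f₁ , f₂ , f₃) = V3-≡
    (solve 9 (λ s₁ s₂ s₃ e₁ e₂ e₃ f₁ f₂ f₃ → let s = s₁ , s₂ , s₃ ; e = e₁ , e₂ , e₃ ; f = f₁ , f₂ , f₃ in
       proj₁ (crossₚ (crossₚ s e) (crossₚ s f)) := proj₁ (det3ₚ s e f ·ₚ s)) refl s₁ s₂ s₃ e₁ e₂ e₃ f₁ f₂ f₃)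
    (solve 9 (λ s₁ s₂ s₃ e₁ e₂ e₃ f₁ f₂ f₃ → let s = s₁ , s₂ , s₃ ; e = e₁ , e₂ , e₃ ; f = f₁ , f₂ , f₃ in
       proj₁ (proj₂ (crossₚ (crossₚ s e) (crossₚ s f))) := proj₁ (proj₂ (det3ₚ s e f ·ₚ s))) refl s₁ s₂ s₃ e₁ e₂ e₃ f₁ f₂ f₃)
    (solve 9 (λ s₁ s₂ s₃ e₁ e₂ e₃ f₁ f₂ f₃ → let s = s₁ , s₂ , s₃ ; e = e₁ , e₂ , e₃ ; f = f₁ , f₂ , f₃ in
       proj₂ (proj₂ (crossₚ (crossₚ s e) (crossₚ s f))) := proj₂ (proj₂ (det3ₚ s e f ·ₚ s))) refl s₁ s₂ s₃ e₁ e₂ e₃ f₁ f₂ f₃)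

  det3≡dot-cross : ∀ a b c → det3 a b c ≡ dot c (cross a b)
  det3≡dot-cross (a₁ , a₂ , a₃) (b₁ , b₂ , b₃) (c₁ , c₂ , c₃) =
    solve 9 (λ a₁ a₂ a₃ b₁ b₂ b₃ c₁ c₂ c₃ → let a = a₁ , a₂ , a₃ ; b = b₁ , b₂ , b₃ ; c = c₁ , c₂ , c₃ in
               det3ₚ a b c := dotₚ c (crossₚ a b)) refl a₁ a₂ a₃ b₁ b₂ b₃ c₁ c₂ c₃

  det3-swap₁₂ : ∀ a b c → det3 b a c ≡ - det3 a b c
  det3-swap₁₂ (a₁ , a₂ , a₃) (b₁ , b₂ , b₃) (c₁ , c₂ , c₃) =
    solve 9 (λ a₁ a₂ a₃ b₁ b₂ b₃ c₁ c₂ c₃ → let a = a₁ , a₂ , a₃ ; b = b₁ , b₂ , b₃ ; c = c₁ , c₂ , c₃ in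
               det3ₚ b a c := :- det3ₚ a b c) refl a₁ a₂ a₃ b₁ b₂ b₃ c₁ c₂ c₃

  det3-zero-row : ∀ a b c → zc a ≡ 0# → zc b ≡ 0# → zc c ≡ 0# → det3 a b c ≡ 0#
  det3-zero-row (a₁ , a₂ , _) (b₁ , b₂ , _) (c₁ , c₂ , _) refl refl refl =
    solve 6 (λ a₁ a₂ b₁ b₂ c₁ c₂ → det3ₚ (a₁ , a₂ , 0ₚ) (b₁ , b₂ , 0ₚ) (c₁ , c₂ , 0ₚ) := 0ₚ) refl a₁ a₂ b₁ b₂ c₁ c₂

  det3-e₂e₃ : ∀ s → det3 s (0# , 1# , 0#) (0# , 0# , 1#) ≡ proj₁ s
  det3-e₂e₃ (s₁ , s₂ , s₃) = solve 3 (λ s₁ s₂ s₃ → det3ₚ (s₁ , s₂ , s₃) (0ₚ , 1ₚ , 0ₚ) (0ₚ , 0ₚ , 1ₚ) := s₁) refl s₁ s₂ s₃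

  det3-e₃e₁ : ∀ s → det3 s (0# , 0# , 1#) (1# , 0# , 0#) ≡ proj₁ (proj₂ s)
  det3-e₃e₁ (s₁ , s₂ , s₃) = solve 3 (λ s₁ s₂ s₃ → det3ₚ (s₁ , s₂ , s₃) (0ₚ , 0ₚ , 1ₚ) (1ₚ , 0ₚ , 0ₚ) := s₂) refl s₁ s₂ s₃

  det3-e₁e₂ : ∀ s → det3 s (1# , 0# , 0#) (0# , 1# , 0#) ≡ proj₂ (proj₂ s)
  det3-e₁e₂ (s₁ , s₂ , s₃) = solve 3 (λ s₁ s₂ s₃ → det3ₚ (s₁ , s₂ , s₃) (1ₚ , 0ₚ , 0ₚ) (0ₚ , 1ₚ , 0ₚ) := s₃) refl s₁ s₂ s₃

  linear-· : ∀ a b c k x → linear a b c (k · x) ≡ k · linear a b c x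
  linear-· (a₁ , a₂ , a₃) (b₁ , b₂ , b₃) (c₁ , c₂ , c₃) k (x₁ , x₂ , x₃) = V3-≡
    (solve 13 (λ a₁ a₂ a₃ b₁ b₂ b₃ c₁ c₂ c₃ k x₁ x₂ x₃ → let a = a₁ , a₂ , a₃ ; b = b₁ , b₂ , b₃ ; c = c₁ , c₂ , c₃ ; x = x₁ , x₂ , x₃ in
       proj₁ (linearₚ a b c (k ·ₚ x)) := proj₁ (k ·ₚ linearₚ a b c x)) refl a₁ a₂ a₃ b₁ b₂ b₃ c₁ c₂ c₃ k x₁ x₂ x₃)
    (solve 13 (λ a₁ a₂ a₃ b₁ b₂ b₃ c₁ c₂ c₃ k x₁ x₂ x₃ → let a = a₁ , a₂ , a₃ ; b = b₁ , b₂ , b₃ ; c = c₁ , c₂ , c₃ ; x = x₁ , x₂ , x₃ in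
       proj₁ (proj₂ (linearₚ a b c (k ·ₚ x))) := proj₁ (proj₂ (k ·ₚ linearₚ a b c x))) refl a₁ a₂ a₃ b₁ b₂ b₃ c₁ c₂ c₃ k x₁ x₂ x₃)
    (solve 13 (λ a₁ a₂ a₃ b₁ b₂ b₃ c₁ c₂ c₃ k x₁ x₂ x₃ → let a = a₁ , a₂ , a₃ ; b = b₁ , b₂ , b₃ ; c = c₁ , c₂ , c₃ ; x = x₁ , x₂ , x₃ in
       proj₂ (proj₂ (linearₚ a b c (k ·ₚ x))) := proj₂ (proj₂ (k ·ₚ linearₚ a b c x))) refl a₁ a₂ a₃ b₁ b₂ b₃ c₁ c₂ c₃ k x₁ x₂ x₃)

  linear-adjugate : ∀ a b c y → linear a b c (adjugate a b c y) ≡ det3 a b c · y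
  linear-adjugate (a₁ , a₂ , a₃) (b₁ , b₂ , b₃) (c₁ , c₂ , c₃) (y₁ , y₂ , y₃) = V3-≡
    (solve 12 (λ a₁ a₂ a₃ b₁ b₂ b₃ c₁ c₂ c₃ y₁ y₂ y₃ → let a = a₁ , a₂ , a₃ ; b = b₁ , b₂ , b₃ ; c = c₁ , c₂ , c₃ ; y = y₁ , y₂ , y₃ in
       proj₁ (linearₚ a b c (adjugateₚ a b c y)) := proj₁ (det3ₚ a b c ·ₚ y)) refl a₁ a₂ a₃ b₁ b₂ b₃ c₁ c₂ c₃ y₁ y₂ y₃)
    (solve 12 (λ a₁ a₂ a₃ b₁ b₂ b₃ c₁ c₂ c₃ y₁ y₂ y₃ → let a = a₁ , a₂ , a₃ ; b = b₁ , b₂ , b₃ ; c = c₁ , c₂ , c₃ ; y = y₁ , y₂ , y₃ in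
       proj₁ (proj₂ (linearₚ a b c (adjugateₚ a b c y))) := proj₁ (proj₂ (det3ₚ a b c ·ₚ y))) refl a₁ a₂ a₃ b₁ b₂ b₃ c₁ c₂ c₃ y₁ y₂ y₃)
    (solve 12 (λ a₁ a₂ a₃ b₁ b₂ b₃ c₁ c₂ c₃ y₁ y₂ y₃ → let a = a₁ , a₂ , a₃ ; b = b₁ , b₂ , b₃ ; c = c₁ , c₂ , c₃ ; y = y₁ , y₂ , y₃ in
       proj₂ (proj₂ (linearₚ a b c (adjugateₚ a b c y))) := proj₂ (proj₂ (det3ₚ a b c ·ₚ y))) refl a₁ a₂ a₃ b₁ b₂ b₃ c₁ c₂ c₃ y₁ y₂ y₃)

  adjugate-linear : ∀ a b c x → adjugate a b c (linear a b c x) ≡ det3 a b c · x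
  adjugate-linear (a₁ , a₂ , a₃) (b₁ , b₂ , b₃) (c₁ , c₂ , c₃) (x₁ , x₂ , x₃) = V3-≡
    (solve 12 (λ a₁ a₂ a₃ b₁ b₂ b₃ c₁ c₂ c₃ x₁ x₂ x₃ → let a = a₁ , a₂ , a₃ ; b = b₁ , b₂ , b₃ ; c = c₁ , c₂ , c₃ ; x = x₁ , x₂ , x₃ in
       proj₁ (adjugateₚ a b c (linearₚ a b c x)) := proj₁ (det3ₚ a b c ·ₚ x)) refl a₁ a₂ a₃ b₁ b₂ b₃ c₁ c₂ c₃ x₁ x₂ x₃)
    (solve 12 (λ a₁ a₂ a₃ b₁ b₂ b₃ c₁ c₂ c₃ x₁ x₂ x₃ → let a = a₁ , a₂ , a₃ ; b = b₁ , b₂ , b₃ ; c = c₁ , c₂ , c₃ ; x = x₁ , x₂ , x₃ in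
       proj₁ (proj₂ (adjugateₚ a b c (linearₚ a b c x))) := proj₁ (proj₂ (det3ₚ a b c ·ₚ x))) refl a₁ a₂ a₃ b₁ b₂ b₃ c₁ c₂ c₃ x₁ x₂ x₃)
    (solve 12 (λ a₁ a₂ a₃ b₁ b₂ b₃ c₁ c₂ c₃ x₁ x₂ x₃ → let a = a₁ , a₂ , a₃ ; b = b₁ , b₂ , b₃ ; c = c₁ , c₂ , c₃ ; x = x₁ , x₂ , x₃ in
       proj₂ (proj₂ (adjugateₚ a b c (linearₚ a b c x))) := proj₂ (proj₂ (det3ₚ a b c ·ₚ x))) refl a₁ a₂ a₃ b₁ b₂ b₃ c₁ c₂ c₃ x₁ x₂ x₃)

  private
    ratio : ∀ {uᵢ wᵢ uⱼ wⱼ} → wᵢ ≢ 0# → uⱼ * wᵢ - uᵢ * wⱼ ≡ 0# → uⱼ ≡ (uᵢ / wᵢ) * wⱼ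
    ratio {uᵢ} {wᵢ} {uⱼ} {wⱼ} wᵢ≢0 cross≡0 = *-cancelˡ uⱼ _ wᵢ≢0 (begin
      wᵢ * uⱼ               ≡⟨ *-comm wᵢ uⱼ ⟩
      uⱼ * wᵢ               ≡⟨ x-y≡0⇒x≡y cross≡0 ⟩
      uᵢ * wⱼ               ≡⟨ cong (_* wⱼ) (/-*-cancel wᵢ≢0) ⟨
      ((uᵢ / wᵢ) * wᵢ) * wⱼ   ≡⟨ solve 3 (λ a w b → (a :* w) :* b := w :* (a :* b)) refl (uᵢ / wᵢ) wᵢ wⱼ ⟩
      wᵢ * ((uᵢ / wᵢ) * wⱼ)   ∎)

    -ratio : ∀ {uᵢ wᵢ uⱼ wⱼ} → wᵢ ≢ 0# → uᵢ * wⱼ - uⱼ * wᵢ ≡ 0# → uⱼ ≡ (uᵢ / wᵢ) * wⱼ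
    -ratio wᵢ≢0 cross≡0 = ratio wᵢ≢0 (trans (solve 4 (λ a b c d → c :* d :- a :* b := :- (a :* b :- c :* d)) refl _ _ _ _)
                                            (trans (cong -_ cross≡0) -0#≈0#))

  cross≡0⇒proportional : ∀ u w → NonZero3 w → cross u w ≡ zero3 → Σ Carrier λ c → u ≡ c · w
  cross≡0⇒proportional (u₁ , u₂ , u₃) (w₁ , w₂ , w₃) w≢0 u×w≡0 with w₁ ≟ 0# | w₂ ≟ 0# | w₃ ≟ 0#
  ... | no w₁≢0 | _ | _ = u₁ / w₁ , V3-≡ (sym (/-*-cancel w₁≢0)) (-ratio w₁≢0 c₃) (ratio w₁≢0 c₂)
    where c₂ = cong (proj₁ ∘ proj₂) u×w≡0 ; c₃ = cong (proj₂ ∘ proj₂) u×w≡0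
  ... | yes _ | no w₂≢0 | _ = u₂ / w₂ , V3-≡ (ratio w₂≢0 c₃) (sym (/-*-cancel w₂≢0)) (-ratio w₂≢0 c₁)
    where c₁ = cong proj₁ u×w≡0 ; c₃ = cong (proj₂ ∘ proj₂) u×w≡0
  ... | yes _ | yes _ | no w₃≢0 = u₃ / w₃ , V3-≡ (-ratio w₃≢0 c₂) (ratio w₃≢0 c₁) (sym (/-*-cancel w₃≢0))
    where c₁ = cong proj₁ u×w≡0 ; c₂ = cong (proj₁ ∘ proj₂) u×w≡0
  ... | yes w₁≡0 | yes w₂≡0 | yes w₃≡0 = contradiction (V3-≡ w₁≡0 w₂≡0 w₃≡0) w≢0

module Plane (q : ℕ) (q-pp : IsPrimePower q) (F : FiniteField (q ^ 2)) where
  open Subfield q q-pp F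
  open Vectors q F
  open Formal
  open PG q F using (V3; zero3; NonZero3; _·_; _⊕_; zc; dot; det3; Same; OnLinf; SubVec; BaerSubplane; embed; InB; TangentAt; LinfBaerPencil; InPencil; ConicB; evalQ; four; Degenerate; Affine; InConic; ExtContains)
  open ≡.≡-Reasoning

  Same-refl : ∀ {Y} → Same Y Y
  Same-refl {Y} = 1# , 1≢0 , sym (·-identity Y)

  Same-sym : ∀ {Y W} → Same Y W → Same W Y
  Same-sym (c , c≢0 , Y≡cW) = c ⁻¹ , ⁻¹-≢0 c≢0 , ·-solve c≢0 Y≡cW

  Same-trans : ∀ {X Y Z} → Same X Y → Same Y Z → Same X Z
  Same-trans {Z = Z} (c , c≢0 , X≡cY) (d , d≢0 , Y≡dZ) =
    c * d , *-≢0 c≢0 d≢0 , trans X≡cY (trans (cong (c ·_) Y≡dZ) (·-assoc c d Z))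

  conjV : V3 → V3
  conjV (x , y , z) = conj x , conj y , conj z

  conj-dot : ∀ u {x} → SubVec x → conj (dot u x) ≡ dot (conjV u) x
  conj-dot (u₁ , u₂ , u₃) {x₁ , x₂ , x₃} (x₁∈ , x₂∈ , x₃∈) = begin
    conj (u₁ * x₁ + u₂ * x₂ + u₃ * x₃)                      ≡⟨ trans (conj-+ _ _) (cong (_+ _) (conj-+ _ _)) ⟩
    conj (u₁ * x₁) + conj (u₂ * x₂) + conj (u₃ * x₃)       ≡⟨ cong₂ _+_ (cong₂ _+_ (term u₁ x₁∈) (term u₂ x₂∈)) (term u₃ x₃∈) ⟩
    conj u₁ * x₁ + conj u₂ * x₂ + conj u₃ * x₃              ∎
    where
    term : ∀ u {x} → InSub x → conj (u * x) ≡ conj u * x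
    term u {x} x∈ = trans (conj-* u x) (cong (conj u *_) x∈)

  cross-Sub : ∀ {u v} → SubVec u → SubVec v → SubVec (cross u v)
  cross-Sub (u₁∈ , u₂∈ , u₃∈) (v₁∈ , v₂∈ , v₃∈) =
    InSub-- (InSub-* u₂∈ v₃∈) (InSub-* u₃∈ v₂∈) , InSub-- (InSub-* u₃∈ v₁∈) (InSub-* u₁∈ v₃∈) ,
    InSub-- (InSub-* u₁∈ v₂∈) (InSub-* u₂∈ v₁∈)

  module Subplane (B : BaerSubplane) where
    open BaerSubplane B

    -- ℓ∞ in the coordinates of B
    L : V3
    L = zc a1 , zc a2 , zc a3

    zc-embed : ∀ x → zc (embed B x) ≡ dot L x
    zc-embed = zc-linear a1 a2 a3

    embed-injective : ∀ {x y c} → embed B x ≡ c · embed B y → x ≡ c · y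
    embed-injective {x} {y} {c} eq = ·-cancel x (c · y) invertible (begin
      det3 a1 a2 a3 · x                   ≡⟨ adjugate-linear a1 a2 a3 x ⟨
      adjugate a1 a2 a3 (embed B x)        ≡⟨ cong (adjugate a1 a2 a3) (trans eq (sym (linear-· a1 a2 a3 c y))) ⟩
      adjugate a1 a2 a3 (embed B (c · y))  ≡⟨ adjugate-linear a1 a2 a3 (c · y) ⟩
      det3 a1 a2 a3 · (c · y)             ∎)

    embed-≢0 : ∀ {x} → NonZero3 x → NonZero3 (embed B x)
    embed-≢0 {x} x≢0 emb≡0 = x≢0 (trans (embed-injective (trans emb≡0 (sym (·-zeroˡ (embed B zero3))))) (·-zeroˡ zero3))

    L≢0 : NonZero3 L
    L≢0 L≡0 = invertible (det3-zero-row a1 a2 a3 (cong proj₁ L≡0) (cong (proj₁ ∘ proj₂) L≡0) (cong (proj₂ ∘ proj₂) L≡0))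

  module Tangency (B : BaerSubplane) (T : V3) (tangent : TangentAt B T) where
    open Subplane B public

    M : V3
    M = conjV L

    t : V3
    t = proj₁ (proj₁ (proj₂ tangent))

    t-Sub : SubVec t
    t-Sub = proj₁ (proj₂ (proj₁ (proj₂ tangent)))

    t≢0 : NonZero3 t
    t≢0 = proj₁ (proj₂ (proj₂ (proj₁ (proj₂ tangent))))

    T∼t : Same T (embed B t)
    T∼t = proj₂ (proj₂ (proj₂ (proj₁ (proj₂ tangent))))

    L·t≡0 : dot L t ≡ 0#
    L·t≡0 with T∼t
    ... | c , c≢0 , T≡c·t = x*y≡0⇒y≡0 c≢0 (begin
      c * dot L t           ≡⟨ cong (c *_) (zc-embed t) ⟨
      zc (c · embed B t)    ≡⟨ cong zc T≡c·t ⟨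
      zc T                  ≡⟨ proj₁ (proj₂ (proj₂ tangent)) ⟩
      0#                    ∎)

    M·t≡0 : dot M t ≡ 0#
    M·t≡0 = trans (sym (conj-dot L t-Sub)) (trans (cong conj L·t≡0) conj-0)

    on-ℓ∞⇒∼T : ∀ {x} → SubVec x → NonZero3 x → dot L x ≡ 0# → Same (embed B x) T
    on-ℓ∞⇒∼T {x} x∈ x≢0 L·x≡0 = proj₂ (proj₂ (proj₂ tangent)) (embed B x) (embed-≢0 x≢0)
                                   (x , x∈ , x≢0 , Same-refl) (trans (zc-embed x) L·x≡0)

    on-ℓ∞-proportional : ∀ {a b} → SubVec a → SubVec b → dot L a ≡ 0# → dot L b ≡ 0# → cross a b ≡ zero3
    on-ℓ∞-proportional {a} {b} a∈ b∈ L·a≡0 L·b≡0 with a ≟V zero3 | b ≟V zero3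
    ... | yes refl | _        = cross-zeroˡ b
    ... | no _     | yes refl = cross-zeroʳ a
    ... | no a≢0   | no b≢0   = proportional (Same-trans (on-ℓ∞⇒∼T a∈ a≢0 L·a≡0) (Same-sym (on-ℓ∞⇒∼T b∈ b≢0 L·b≡0)))
      where
      proportional : Same (embed B a) (embed B b) → cross a b ≡ zero3
      proportional (c , _ , a≡cb) = trans (cong (λ v → cross v b) (embed-injective a≡cb)) (cross-·-self c b)

    private
      e₁ e₂ e₃ : V3
      e₁ = 1# , 0# , 0#
      e₂ = 0# , 1# , 0#
      e₃ = 0# , 0# , 1#

      InSub-swap : ∀ {x y} → x * conj y ≡ y * conj x → InSub (conj x * y)
      InSub-swap {x} {y} eq = trans (conj-* (conj x) y) (trans (cong (_* conj y) (conj-involutive x)) (trans eq (*-comm y _)))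

      det·s≡0 : ∀ c e f → SubVec (c · L) → SubVec e → SubVec f → det3 (c · L) e f · (c · L) ≡ zero3
      det·s≡0 c e f s∈ e∈ f∈ = trans (sym (cross-of-crosses (c · L) e f))
        (on-ℓ∞-proportional (cross-Sub s∈ e∈) (cross-Sub s∈ f∈) (dot-cross-scaled c L e) (dot-cross-scaled c L f))

      coordinate≡0 : ∀ (sel : V3 → Carrier) e f → SubVec e → SubVec f → (∀ s → det3 s e f ≡ sel s) →
                     (∀ d v → sel (d · v) ≡ d * sel v) → sel zero3 ≡ 0# →
                     SubVec (conj (sel L) · L) → sel L ≡ 0#
      coordinate≡0 sel e f e∈ f∈ det≡sel sel-· sel-0 s∈ = norm≡0⇒≡0 (square≡0⇒≡0 (begin
        N * N                                   ≡⟨ cong (_* N) (trans (det≡sel s) (sel-· (conj x) L)) ⟨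
        det3 s e f * N                          ≡⟨ cong (det3 s e f *_) (sel-· (conj x) L) ⟨
        det3 s e f * sel s                      ≡⟨ sel-· (det3 s e f) s ⟨
        sel (det3 s e f · s)                    ≡⟨ cong sel (det·s≡0 (conj x) e f s∈ e∈ f∈) ⟩
        sel zero3                               ≡⟨ sel-0 ⟩
        0#                                      ∎))
        where
        x = sel L
        s = conj x · L
        N = conj x * x

    -- Otherwise each L̄ᵢ · L is a B-vector. Its cross products with two unit vectors are B-vectors
    -- on ℓ∞, hence proportional by tangency, yet their cross product is L̄ᵢ Lᵢ · (L̄ᵢ · L); so Lᵢ = 0.
    L×M≢0 : NonZero3 (cross L M)
    L×M≢0 L×M≡0 = L≢0 (V3-≡
      (coordinate≡0 proj₁ e₂ e₃ Sub-e₂ Sub-e₃ det3-e₂e₃ (λ _ _ → refl) refl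
        (InSub-swap refl , InSub-swap c₃ , InSub-swap (sym c₂)))
      (coordinate≡0 (proj₁ ∘ proj₂) e₃ e₁ Sub-e₃ Sub-e₁ det3-e₃e₁ (λ _ _ → refl) refl
        (InSub-swap (sym c₃) , InSub-swap refl , InSub-swap c₁))
      (coordinate≡0 (proj₂ ∘ proj₂) e₁ e₂ Sub-e₁ Sub-e₂ det3-e₁e₂ (λ _ _ → refl) refl
        (InSub-swap c₂ , InSub-swap (sym c₁) , InSub-swap refl)))
      where
      c₁ = x-y≡0⇒x≡y (cong proj₁ L×M≡0)
      c₂ = x-y≡0⇒x≡y (cong (proj₁ ∘ proj₂) L×M≡0)
      c₃ = x-y≡0⇒x≡y (cong (proj₂ ∘ proj₂) L×M≡0)
      Sub-e₁ : SubVec e₁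
      Sub-e₁ = InSub-1 , InSub-0 , InSub-0
      Sub-e₂ : SubVec e₂
      Sub-e₂ = InSub-0 , InSub-1 , InSub-0
      Sub-e₃ : SubVec e₃
      Sub-e₃ = InSub-0 , InSub-0 , InSub-1

    some-coordinate-∉ : Σ Carrier λ ε → ¬ InSub ε
    some-coordinate-∉ with InSub? (proj₁ L) | InSub? (proj₁ (proj₂ L)) | InSub? (proj₂ (proj₂ L))
    ... | no ∉  | _     | _    = proj₁ L , ∉
    ... | yes _ | no ∉  | _    = proj₁ (proj₂ L) , ∉
    ... | yes _ | yes _ | no ∉ = proj₂ (proj₂ L) , ∉
    ... | yes ∈₁ | yes ∈₂ | yes ∈₃ =
      contradiction (trans (cong (cross L) (V3-≡ ∈₁ ∈₂ ∈₃)) (cross-self L)) L×M≢0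

    common-zero⇒∝L×M : ∀ y → dot L y ≡ 0# → dot M y ≡ 0# → Σ Carrier λ c → y ≡ c · cross L M
    common-zero⇒∝L×M y L·y≡0 M·y≡0 = cross≡0⇒proportional y (cross L M) L×M≢0
      (cross-cross≡0 y L M (trans (dot-comm y L) L·y≡0) (trans (dot-comm y M) M·y≡0))

    common-zero⇒∝t : ∀ {x} → dot L x ≡ 0# → dot M x ≡ 0# → Σ Carrier λ c → x ≡ c · t
    common-zero⇒∝t {x} L·x≡0 M·x≡0 = combine (common-zero⇒∝L×M x L·x≡0 M·x≡0) (common-zero⇒∝L×M t L·t≡0 M·t≡0)
      where
      combine : (Σ Carrier λ α → x ≡ α · cross L M) → (Σ Carrier λ β → t ≡ β · cross L M) → Σ Carrier λ c → x ≡ c · t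
      combine (α , x≡αw) (β , t≡βw) = α * β ⁻¹ , (begin
        x                          ≡⟨ x≡αw ⟩
        α · cross L M              ≡⟨ cong (α ·_) (·-solve β≢0 t≡βw) ⟩
        α · ((β ⁻¹) · t)           ≡⟨ ·-assoc α (β ⁻¹) t ⟩
        (α * β ⁻¹) · t             ∎)
        where
        β≢0 : β ≢ 0#
        β≢0 β≡0 = t≢0 (trans t≡βw (trans (cong (_· cross L M) β≡0) (·-zeroˡ (cross L M))))

  module Pencils {ε} (ε∉ : ¬ InSub ε) (P₁ P₂ : Carrier) (P≢0 : NonZero3 (P₁ , P₂ , 0#)) where
    open Coordinates ε∉ using (δ; δ≢0)

    P : V3
    P = P₁ , P₂ , 0#

    -- The line through P and (0 : 0 : 1), as a linear form: lines on P are dot ℓP ≡ λ · zc.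
    ℓP : V3
    ℓP = P₂ , - P₁ , 0#

    slope : V3 → Carrier
    slope Y = dot ℓP Y / zc Y

    conj-δ : conj δ ≡ - δ
    conj-δ = conj-antisymmetric ε

    e : Carrier
    e = ε / δ

    trace-e : trace e ≡ 1#
    trace-e = begin
      ε / δ + conj (ε / δ)         ≡⟨ cong (ε / δ +_) (trans (conj-/ ε δ) (cong (conj ε /_) conj-δ)) ⟩
      ε / δ + conj ε / (- δ)       ≡⟨ cong (ε / δ +_) (trans (cong (_/ (- δ)) (sym (-‿involutive (conj ε)))) (‿/‿ δ≢0)) ⟩
      ε / δ + (- conj ε) / δ       ≡⟨ distribʳ (δ ⁻¹) ε (- conj ε) ⟨
      δ / δ                        ≡⟨ ⁻¹-inverseʳ δ≢0 ⟩
      1#                           ∎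

    private
      direction : Σ Carrier λ D₁ → Σ Carrier λ D₂ → dot ℓP (D₁ , D₂ , 0#) ≡ 1#
      direction with P₁ ≟ 0#
      ... | no P₁≢0 = 0# , - (P₁ ⁻¹) , trans
        (solve 3 (λ p₁ p₂ i → p₂ :* 0ₚ :+ (:- p₁) :* (:- i) :+ 0ₚ :* 0ₚ := p₁ :* i) refl P₁ P₂ (P₁ ⁻¹))
        (⁻¹-inverseʳ P₁≢0)
      ... | yes P₁≡0 = P₂ ⁻¹ , 0# , trans
        (solve 3 (λ p₁ p₂ i → p₂ :* i :+ (:- p₁) :* 0ₚ :+ 0ₚ :* 0ₚ := p₂ :* i) refl P₁ P₂ (P₂ ⁻¹))
        (⁻¹-inverseʳ (λ P₂≡0 → P≢0 (V3-≡ P₁≡0 P₂≡0 refl)))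

    D : V3
    D = proj₁ direction , proj₁ (proj₂ direction) , 0#

    ℓP·D≡1 : dot ℓP D ≡ 1#
    ℓP·D≡1 = proj₂ (proj₂ direction)

    base : Carrier → V3
    base k = (0# , 0# , 1#) ⊕ ((k * e) · D)

    ray : Carrier → Carrier → Carrier → Carrier → V3
    ray k β s t = β · ((s · base k) ⊕ (t · (δ · D)))

    zc-ray : ∀ k β s t → zc (ray k β s t) ≡ β * s
    zc-ray k β s t = solve 5 (λ c w β s t → β :* (s :* (1ₚ :+ c :* 0ₚ) :+ t :* (w :* 0ₚ)) := β :* s) refl (k * e) δ β s t

    ℓP-ray : ∀ k β s t → dot ℓP (ray k β s t) ≡ β * (s * (k * e) + t * δ)
    ℓP-ray k β s t = trans
      (solve 9 (λ p₁ p₂ d₁ d₂ c w β s t → let Dₚ = d₁ , d₂ , 0ₚ in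
         dotₚ (p₂ , :- p₁ , 0ₚ) (β ·ₚ ((s ·ₚ ((0ₚ , 0ₚ , 1ₚ) ⊕ₚ (c ·ₚ Dₚ))) ⊕ₚ (t ·ₚ (w ·ₚ Dₚ))))
           := β :* (s :* c :+ t :* w) :* dotₚ (p₂ , :- p₁ , 0ₚ) Dₚ)
         refl P₁ P₂ (proj₁ D) (proj₁ (proj₂ D)) (k * e) δ β s t)
      (trans (cong (β * (s * (k * e) + t * δ) *_) ℓP·D≡1) (*-identityʳ _))

    ℓP·P≡0 : ∀ α → dot ℓP (α · P) ≡ 0#
    ℓP·P≡0 α = solve 3 (λ p₁ p₂ α → dotₚ (p₂ , :- p₁ , 0ₚ) (α ·ₚ (p₁ , p₂ , 0ₚ)) := 0ₚ) refl P₁ P₂ α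

    pencil : Carrier → LinfBaerPencil P
    pencil k = record
      { u             = base k
      ; v             = δ · D
      ; vertexOnLinf  = refl
      ; vertexOff     = λ det≡0 → δ≢0 (begin
          δ                         ≡⟨ *-identityʳ δ ⟨
          δ * 1#                    ≡⟨ cong (δ *_) ℓP·D≡1 ⟨
          δ * dot ℓP D              ≡⟨ det3-pencil ⟨
          det3 P (base k) (δ · D)   ≡⟨ det≡0 ⟩
          0#                        ∎)
      ; baseMeetsLinf = 0# , 1# , InSub-0 , InSub-1 , 1≢0 ∘ proj₂ ,
          solve 2 (λ c w → 0ₚ :* (1ₚ :+ c :* 0ₚ) :+ 1ₚ :* (w :* 0ₚ) := 0ₚ) refl (k * e) δ
      }
      where
      det3-pencil : det3 P (base k) (δ · D) ≡ δ * dot ℓP D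
      det3-pencil = solve 6 (λ p₁ p₂ d₁ d₂ c w → let Dₚ = d₁ , d₂ , 0ₚ in
          det3ₚ (p₁ , p₂ , 0ₚ) ((0ₚ , 0ₚ , 1ₚ) ⊕ₚ (c ·ₚ Dₚ)) (w ·ₚ Dₚ) := w :* dotₚ (p₂ , :- p₁ , 0ₚ) Dₚ)
        refl P₁ P₂ (proj₁ D) (proj₁ (proj₂ D)) (k * e) δ

    zc-point : ∀ k α β s t → zc ((α · P) ⊕ ray k β s t) ≡ β * s
    zc-point k α β s t = trans (cong (α * 0# +_) (zc-ray k β s t)) (solve 2 (λ α x → α :* 0ₚ :+ x := x) refl α (β * s))

    ℓP-point : ∀ k α β s t → dot ℓP ((α · P) ⊕ ray k β s t) ≡ β * (s * (k * e) + t * δ)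
    ℓP-point k α β s t = begin
      dot ℓP ((α · P) ⊕ ray k β s t)                ≡⟨ dot-⊕ ℓP (α · P) (ray k β s t) ⟩
      dot ℓP (α · P) + dot ℓP (ray k β s t)         ≡⟨ cong₂ _+_ (ℓP·P≡0 α) (ℓP-ray k β s t) ⟩
      0# + β * (s * (k * e) + t * δ)                ≡⟨ +-identityˡ _ ⟩
      β * (s * (k * e) + t * δ)                     ∎

    trace-k·e+σ·δ : ∀ {k σ} → InSub k → InSub σ → trace (k * e + σ * δ) ≡ k
    trace-k·e+σ·δ {k} {σ} k∈ σ∈ = begin
      (k * e + σ * δ) + conj (k * e + σ * δ)       ≡⟨ cong ((k * e + σ * δ) +_) conj-k·e+σ·δ ⟩
      (k * e + σ * δ) + (k * conj e + σ * - δ)     ≡⟨ solve 5 (λ k e ē σ δ → (k :* e :+ σ :* δ) :+ (k :* ē :+ σ :* (:- δ)) := k :* (e :+ ē))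
                                                        refl k e (conj e) σ δ ⟩
      k * trace e                                  ≡⟨ cong (k *_) trace-e ⟩
      k * 1#                                       ≡⟨ *-identityʳ k ⟩
      k                                            ∎
      where
      conj-k·e+σ·δ : conj (k * e + σ * δ) ≡ k * conj e + σ * - δ
      conj-k·e+σ·δ = trans (conj-+ _ _) (cong₂ _+_ (trans (conj-* k e) (cong (_* conj e) k∈))
                                                   (trans (conj-* σ δ) (cong₂ _*_ σ∈ conj-δ)))

    in-pencil⇒trace : ∀ {k Y} → InSub k → zc Y ≢ 0# → InPencil (pencil k) Y → trace (slope Y) ≡ k
    in-pencil⇒trace {k} {Y} k∈ Y₃≢0 (s , t , α , β , s∈ , t∈ , _ , Y≡point) = begin
      trace (slope Y)                   ≡⟨ cong trace (x≡z*y⇒x/y≡z Y₃≢0 ℓP·Y≡) ⟩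
      trace (k * e + (t / s) * δ)       ≡⟨ trace-k·e+σ·δ k∈ (InSub-/ t∈ s∈) ⟩
      k                                 ∎
      where
      zc-Y : zc Y ≡ β * s
      zc-Y = trans (cong zc Y≡point) (zc-point k α β s t)
      s≢0 : s ≢ 0#
      s≢0 s≡0 = Y₃≢0 (trans zc-Y (trans (cong (β *_) s≡0) (zeroʳ β)))
      ℓP·Y≡ : dot ℓP Y ≡ (k * e + (t / s) * δ) * zc Y
      ℓP·Y≡ = begin
        dot ℓP Y                                   ≡⟨ trans (cong (dot ℓP) Y≡point) (ℓP-point k α β s t) ⟩
        β * (s * (k * e) + t * δ)                  ≡⟨ cong (λ x → β * (s * (k * e) + x * δ)) (/-*-cancel s≢0) ⟨
        β * (s * (k * e) + ((t / s) * s) * δ)      ≡⟨ solve 5 (λ β s c σ δ → β :* (s :* c :+ (σ :* s) :* δ) := (c :+ σ :* δ) :* (β :* s))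
                                                        refl β s (k * e) (t / s) δ ⟩
        (k * e + (t / s) * δ) * (β * s)            ≡⟨ cong ((k * e + (t / s) * δ) *_) zc-Y ⟨
        (k * e + (t / s) * δ) * zc Y               ∎

    on-ℓ∞-and-OP⇒∝P : ∀ Z → zc Z ≡ 0# → dot ℓP Z ≡ 0# → Σ Carrier λ α → Z ≡ α · P
    on-ℓ∞-and-OP⇒∝P Z@(Z₁ , Z₂ , _) refl ℓP·Z≡0 = cross≡0⇒proportional Z P P≢0 (V3-≡
      (solve 2 (λ z p → z :* 0ₚ :- 0ₚ :* p := 0ₚ) refl Z₂ P₂)
      (solve 2 (λ p z → 0ₚ :* p :- z :* 0ₚ := 0ₚ) refl P₁ Z₁)
      (trans (solve 4 (λ z₁ z₂ p₁ p₂ → z₁ :* p₂ :- z₂ :* p₁ := dotₚ (p₂ , :- p₁ , 0ₚ) (z₁ , z₂ , 0ₚ)) refl Z₁ Z₂ P₁ P₂) ℓP·Z≡0))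

    trace⇒in-pencil : ∀ {k Y} → InSub k → zc Y ≢ 0# → trace (slope Y) ≡ k → InPencil (pencil k) Y
    trace⇒in-pencil {k} {Y} k∈ Y₃≢0 trace≡k =
      1# , σ , proj₁ Z∝P , zc Y , InSub-1 , σ∈ , 1≢0 ∘ proj₁ , (begin
        Y                       ≡⟨ ⊖-⊕ Y W ⟨
        (Y ⊖ W) ⊕ W             ≡⟨ cong (_⊕ W) (proj₂ Z∝P) ⟩
        (proj₁ Z∝P · P) ⊕ W     ∎)
      where
      ρ = slope Y
      σ = (ρ - k * e) / δ
      W = ray k (zc Y) 1# σ

      σ∈ : InSub σ
      σ∈ = InSub-/-antiInvariant (begin
        conj (ρ - k * e)              ≡⟨ trans (conj-- ρ (k * e)) (cong (λ x → conj ρ - x) (trans (conj-* k e) (cong (_* conj e) k∈))) ⟩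
        conj ρ - k * conj e           ≡⟨ cong₂ (λ a b → a - k * b) (x+y≡z⇒y≡z-x trace≡k) (x+y≡z⇒y≡z-x trace-e) ⟩
        (k - ρ) - k * (1# - e)        ≡⟨ solve 3 (λ ρ k e → (k :- ρ) :- k :* (1ₚ :- e) := :- (ρ :- k :* e)) refl ρ k e ⟩
        - (ρ - k * e)                 ∎) conj-δ δ≢0

      k·e+σ·δ≡ρ : k * e + σ * δ ≡ ρ
      k·e+σ·δ≡ρ = trans (cong (k * e +_) (/-*-cancel δ≢0)) (solve 2 (λ a r → a :+ (r :- a) := r) refl (k * e) ρ)

      zc-Z : zc (Y ⊖ W) ≡ 0#
      zc-Z = trans (cong (λ x → zc Y - x) (trans (zc-ray k (zc Y) 1# σ) (*-identityʳ _))) (-‿inverseʳ (zc Y))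

      ℓP-Z : dot ℓP (Y ⊖ W) ≡ 0#
      ℓP-Z = begin
        dot ℓP (Y ⊖ W)                                  ≡⟨ dot-⊖ ℓP Y W ⟩
        dot ℓP Y - dot ℓP W                             ≡⟨ cong₂ _-_ (sym (/-*-cancel Y₃≢0)) (ℓP-ray k (zc Y) 1# σ) ⟩
        ρ * zc Y - zc Y * (1# * (k * e) + σ * δ)         ≡⟨ cong (λ x → ρ * zc Y - zc Y * (x + σ * δ)) (*-identityˡ (k * e)) ⟩
        ρ * zc Y - zc Y * (k * e + σ * δ)                ≡⟨ cong (λ x → ρ * zc Y - zc Y * x) k·e+σ·δ≡ρ ⟩
        ρ * zc Y - zc Y * ρ                              ≡⟨ solve 2 (λ r y → r :* y :- y :* r := 0ₚ) refl ρ (zc Y) ⟩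
        0#                                              ∎

      Z∝P : Σ Carrier λ α → Y ⊖ W ≡ α · P
      Z∝P = on-ℓ∞-and-OP⇒∝P (Y ⊖ W) zc-Z ℓP-Z

  quadratic : (a b c f g h : Carrier) → V3 → Carrier
  quadratic a b c f g h (x , y , z) = a * (x * x) + b * (y * y) + c * (z * z) + f * (y * z) + g * (z * x) + h * (x * y)

  quadratic-zero : ∀ {a b c f g h} x → a ≡ 0# → b ≡ 0# → c ≡ 0# → f ≡ 0# → g ≡ 0# → h ≡ 0# → quadratic a b c f g h x ≡ 0#
  quadratic-zero (x , y , z) refl refl refl refl refl refl =
    solve 3 (λ x y z → 0ₚ :* (x :* x) :+ 0ₚ :* (y :* y) :+ 0ₚ :* (z :* z) :+ 0ₚ :* (y :* z) :+ 0ₚ :* (z :* x) :+ 0ₚ :* (x :* y) := 0ₚ)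
      refl x y z

  discriminant : (a b c f g h : Carrier) → Carrier
  discriminant a b c f g h = four * a * b * c + - (a * (f * f)) + - (b * (g * g)) + - (c * (h * h)) + f * g * h

  InSub-discriminant : ∀ {a b c f g h} → InSub a × InSub b × InSub c × InSub f × InSub g × InSub h →
                       InSub (discriminant a b c f g h)
  InSub-discriminant (a∈ , b∈ , c∈ , f∈ , g∈ , h∈) =
    InSub-+ (InSub-+ (InSub-+ (InSub-+ (InSub-* (InSub-* (InSub-* four∈ a∈) b∈) c∈)
                                       (InSub-‿ (InSub-* a∈ (InSub-* f∈ f∈))))
                              (InSub-‿ (InSub-* b∈ (InSub-* g∈ g∈))))
                     (InSub-‿ (InSub-* c∈ (InSub-* h∈ h∈))))
            (InSub-* (InSub-* f∈ g∈) h∈)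
    where
    four∈ : InSub four
    four∈ = InSub-+ (InSub-+ (InSub-+ InSub-1 InSub-1) InSub-1) InSub-1

  conj-det3 : ∀ a b c → conj (det3 a b c) ≡ det3 (conjV a) (conjV b) (conjV c)
  conj-det3 (a₁ , a₂ , a₃) (b₁ , b₂ , b₃) (c₁ , c₂ , c₃) =
    trans (conj-+ _ _) (cong₂ _+_
      (trans (conj-+ _ _) (cong₂ _+_ (term a₁ b₂ c₃ b₃ c₂) (trans (conj-‿ _) (cong -_ (term a₂ b₁ c₃ b₃ c₁)))))
      (term a₃ b₁ c₂ b₂ c₁))
    where
    term : ∀ x y z u w → conj (x * (y * z + - (u * w))) ≡ conj x * (conj y * conj z + - (conj u * conj w))
    term x y z u w = trans (conj-* x _) (cong (conj x *_) (trans (conj-+ _ _)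
                       (cong₂ _+_ (conj-* y z) (trans (conj-‿ _) (cong -_ (conj-* u w))))))

  conjV-involutive : ∀ v → conjV (conjV v) ≡ v
  conjV-involutive (v₁ , v₂ , v₃) = V3-≡ (conj-involutive v₁) (conj-involutive v₂) (conj-involutive v₃)

  module Configuration (B : BaerSubplane) (T : V3) (tangent : TangentAt B T)
                       (P₁ P₂ : Carrier) (P≢0 : NonZero3 (P₁ , P₂ , 0#)) (P≁T : ¬ Same (P₁ , P₂ , 0#) T) where
    open Tangency B T tangent public
    open Pencils (proj₂ some-coordinate-∉) P₁ P₂ P≢0 public
    open BaerSubplane B using (a1; a2; a3; invertible)

    -- The line OP in the coordinates of B.
    Φ : V3
    Φ = dot ℓP a1 , dot ℓP a2 , dot ℓP a3

    G : V3
    G = conjV Φ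

    ℓP-embed : ∀ x → dot ℓP (embed B x) ≡ dot Φ x
    ℓP-embed = dot-linear a1 a2 a3 ℓP

    -- The conic through T whose points in B are the points of the k-th pencil.
    Q : Carrier → V3 → Carrier
    Q k x = dot Φ x * dot M x + dot G x * dot L x - k * (dot L x * dot M x)

    det : Carrier
    det = det3 a1 a2 a3

    p : V3
    p = adjugate a1 a2 a3 P

    embed-p : embed B p ≡ det · P
    embed-p = linear-adjugate a1 a2 a3 P

    P∼p : Same P (embed B p)
    P∼p = det ⁻¹ , ⁻¹-≢0 invertible , ·-solve invertible embed-p

    p≢0 : NonZero3 p
    p≢0 p≡0 = P≢0 (·-cancel P zero3 invertible (begin
      det · P          ≡⟨ embed-p ⟨
      embed B p        ≡⟨ cong (embed B) p≡0 ⟩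
      embed B zero3    ≡⟨ cong (embed B) (·-zeroˡ zero3) ⟨
      embed B (0# · zero3) ≡⟨ linear-· a1 a2 a3 0# zero3 ⟩
      0# · embed B zero3   ≡⟨ ·-zeroˡ _ ⟩
      zero3            ≡⟨ ·-zeroʳ det ⟨
      det · zero3      ∎))

    L·p≡0 : dot L p ≡ 0#
    L·p≡0 = trans (sym (zc-embed p)) (trans (cong zc embed-p) (zeroʳ det))

    Φ·p≡0 : dot Φ p ≡ 0#
    Φ·p≡0 = trans (sym (ℓP-embed p)) (trans (cong (dot ℓP) embed-p) (ℓP·P≡0 det))

    -- T is not on the line OP, for otherwise T = P.
    Φ·t≢0 : dot Φ t ≢ 0#
    Φ·t≢0 Φ·t≡0 = P≁T (Same-trans (Same-sym (α , α≢0 , t≡αP)) (Same-sym T∼t))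
      where
      t∝P = on-ℓ∞-and-OP⇒∝P (embed B t) (trans (zc-embed t) L·t≡0) (trans (ℓP-embed t) Φ·t≡0)
      α = proj₁ t∝P
      t≡αP = proj₂ t∝P
      α≢0 : α ≢ 0#
      α≢0 α≡0 = embed-≢0 t≢0 (trans t≡αP (trans (cong (_· P) α≡0) (·-zeroˡ P)))

    M·p≢0 : dot M p ≢ 0#
    M·p≢0 M·p≡0 = P≁T (Same-trans P∼p (Same-trans (c , c≢0 , p≡ct′) (Same-sym T∼t)))
      where
      c = proj₁ (common-zero⇒∝t L·p≡0 M·p≡0)
      p≡ct = proj₂ (common-zero⇒∝t L·p≡0 M·p≡0)
      p≡ct′ : embed B p ≡ c · embed B t
      p≡ct′ = trans (cong (embed B) p≡ct) (linear-· a1 a2 a3 c t)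
      c≢0 : c ≢ 0#
      c≢0 c≡0 = p≢0 (trans p≡ct (trans (cong (_· t) c≡0) (·-zeroˡ t)))

    L₁ L₂ L₃ Φ₁ Φ₂ Φ₃ : Carrier
    L₁ = proj₁ L
    L₂ = proj₁ (proj₂ L)
    L₃ = proj₂ (proj₂ L)
    Φ₁ = proj₁ Φ
    Φ₂ = proj₁ (proj₂ Φ)
    Φ₃ = proj₂ (proj₂ Φ)

    X : Carrier
    X = det3 L M Φ

    X≢0 : X ≢ 0#
    X≢0 X≡0 = Φ·t≢0 (begin
      dot Φ t                    ≡⟨ cong (dot Φ) (proj₂ t∝L×M) ⟩
      dot Φ (β · cross L M)      ≡⟨ dot-· Φ β (cross L M) ⟩
      β * dot Φ (cross L M)      ≡⟨ cong (β *_) (det3≡dot-cross L M Φ) ⟨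
      β * X                      ≡⟨ cong (β *_) X≡0 ⟩
      β * 0#                     ≡⟨ zeroʳ β ⟩
      0#                         ∎)
      where
      t∝L×M = common-zero⇒∝L×M t L·t≡0 M·t≡0
      β = proj₁ t∝L×M

    Q-on-ℓ∞ : ∀ k x → dot L x ≡ 0# → Q k x ≡ dot Φ x * dot M x
    Q-on-ℓ∞ k x L·x≡0 = trans (cong (λ l → dot Φ x * dot M x + dot G x * l - k * (l * dot M x)) L·x≡0)
      (solve 4 (λ φ m g k → φ :* m :+ g :* 0ₚ :- k :* (0ₚ :* m) := φ :* m) refl (dot Φ x) (dot M x) (dot G x) k)

    Q-t : ∀ k → Q k t ≡ 0#
    Q-t k = trans (Q-on-ℓ∞ k t L·t≡0) (trans (cong (dot Φ t *_) M·t≡0) (zeroʳ _))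

    Q-p : ∀ k → Q k p ≡ 0#
    Q-p k = trans (Q-on-ℓ∞ k p L·p≡0) (trans (cong (_* dot M p) Φ·p≡0) (zeroˡ _))

    Q-t⊕p≢0 : ∀ k → Q k (t ⊕ p) ≢ 0#
    Q-t⊕p≢0 k Q≡0 = *-≢0 Φ·t≢0 M·p≢0 (begin
      dot Φ t * dot M p                              ≡⟨ cong₂ _*_ (+-identityʳ _) (+-identityˡ _) ⟨
      (dot Φ t + 0#) * (0# + dot M p)                ≡⟨ cong₂ (λ a b → (dot Φ t + a) * (b + dot M p)) Φ·p≡0 M·t≡0 ⟨
      (dot Φ t + dot Φ p) * (dot M t + dot M p)      ≡⟨ cong₂ _*_ (dot-⊕ Φ t p) (dot-⊕ M t p) ⟨
      dot Φ (t ⊕ p) * dot M (t ⊕ p)                  ≡⟨ Q-on-ℓ∞ k (t ⊕ p) L·t⊕p≡0 ⟨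
      Q k (t ⊕ p)                                    ≡⟨ Q≡0 ⟩
      0#                                             ∎)
      where
      L·t⊕p≡0 : dot L (t ⊕ p) ≡ 0#
      L·t⊕p≡0 = trans (dot-⊕ L t p) (trans (cong₂ _+_ L·t≡0 L·p≡0) (+-identityˡ 0#))

    diagonal : Carrier → Carrier → Carrier → Carrier
    diagonal k φ l = tr₂ φ l - k * (l * conj l)

    offDiagonal : Carrier → Carrier → Carrier → Carrier → Carrier → Carrier
    offDiagonal k φ l φ′ l′ = (tr₂ φ l + tr₂ φ′ l′) - k * tr₂ l′ l

    Q-expansion : ∀ k x → quadratic (diagonal k Φ₁ L₁) (diagonal k Φ₂ L₂) (diagonal k Φ₃ L₃)
                                    (offDiagonal k Φ₂ L₃ Φ₃ L₂) (offDiagonal k Φ₃ L₁ Φ₁ L₃) (offDiagonal k Φ₁ L₂ Φ₂ L₁) x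
                          ≡ Q k x
    Q-expansion k (x₁ , x₂ , x₃) =
      solve 16 (λ l₁ l₂ l₃ m₁ m₂ m₃ φ₁ φ₂ φ₃ g₁ g₂ g₃ k x₁ x₂ x₃ →
        let tr₂ₚ = λ φ g l m → φ :* m :+ g :* l
            diag = λ φ g l m → tr₂ₚ φ g l m :- k :* (l :* m)
            off = λ φ g l m φ′ g′ l′ m′ → (tr₂ₚ φ g l m :+ tr₂ₚ φ′ g′ l′ m′) :- k :* tr₂ₚ l′ m′ l m
            L = l₁ , l₂ , l₃ ; M = m₁ , m₂ , m₃ ; Φ = φ₁ , φ₂ , φ₃ ; G = g₁ , g₂ , g₃ ; x = x₁ , x₂ , x₃
        in quadraticₚ (diag φ₁ g₁ l₁ m₁) (diag φ₂ g₂ l₂ m₂) (diag φ₃ g₃ l₃ m₃)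
             (off φ₂ g₂ l₃ m₃ φ₃ g₃ l₂ m₂) (off φ₃ g₃ l₁ m₁ φ₁ g₁ l₃ m₃) (off φ₁ g₁ l₂ m₂ φ₂ g₂ l₁ m₁) x
           := dotₚ Φ x :* dotₚ M x :+ dotₚ G x :* dotₚ L x :- k :* (dotₚ L x :* dotₚ M x))
        refl L₁ L₂ L₃ (conj L₁) (conj L₂) (conj L₃) Φ₁ Φ₂ Φ₃ (conj Φ₁) (conj Φ₂) (conj Φ₃) k x₁ x₂ x₃

    conic : ∀ k → InSub k → ConicB
    conic k k∈ = record
      { a = diagonal k Φ₁ L₁
      ; b = diagonal k Φ₂ L₂
      ; c = diagonal k Φ₃ L₃
      ; f = offDiagonal k Φ₂ L₃ Φ₃ L₂
      ; g = offDiagonal k Φ₃ L₁ Φ₁ L₃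
      ; h = offDiagonal k Φ₁ L₂ Φ₂ L₁
      ; coeffsSub  = diagonal∈ Φ₁ L₁ , diagonal∈ Φ₂ L₂ , diagonal∈ Φ₃ L₃ ,
                     offDiagonal∈ Φ₂ L₃ Φ₃ L₂ , offDiagonal∈ Φ₃ L₁ Φ₁ L₃ , offDiagonal∈ Φ₁ L₂ Φ₂ L₁
      ; notAllZero = λ (a≡0 , b≡0 , c≡0 , f≡0 , g≡0 , h≡0) →
          Q-t⊕p≢0 k (trans (sym (Q-expansion k (t ⊕ p))) (quadratic-zero (t ⊕ p) a≡0 b≡0 c≡0 f≡0 g≡0 h≡0))
      }
      where
      diagonal∈ : ∀ φ l → InSub (diagonal k φ l)
      diagonal∈ φ l = InSub-- (InSub-tr₂ φ l) (InSub-* k∈ (InSub-norm l))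
      offDiagonal∈ : ∀ φ l φ′ l′ → InSub (offDiagonal k φ l φ′ l′)
      offDiagonal∈ φ l φ′ l′ = InSub-- (InSub-+ (InSub-tr₂ φ l) (InSub-tr₂ φ′ l′)) (InSub-* k∈ (InSub-tr₂ l′ l))

    evalQ-conic : ∀ k k∈ x → evalQ (conic k k∈) x ≡ Q k x
    evalQ-conic k k∈ = Q-expansion k

    Q-Sub : ∀ k {x} → SubVec x → dot L x ≢ 0# →
            Q k x ≡ (dot L x * conj (dot L x)) * (trace (dot Φ x / dot L x) - k)
    Q-Sub k {x} x∈ ℓ≢0 = begin
      Q k x                                         ≡⟨ cong₂ (λ m g → φ * m + g * ℓ - k * (ℓ * m)) (conj-dot L x∈) (conj-dot Φ x∈) ⟨
      φ * conj ℓ + conj φ * ℓ - k * (ℓ * conj ℓ)     ≡⟨ cong (λ y → y * conj ℓ + conj y * ℓ - k * (ℓ * conj ℓ)) (/-*-cancel ℓ≢0) ⟨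
      (ρ * ℓ) * conj ℓ + conj (ρ * ℓ) * ℓ - k * (ℓ * conj ℓ)
                                                    ≡⟨ cong (λ y → (ρ * ℓ) * conj ℓ + y * ℓ - k * (ℓ * conj ℓ)) (conj-* ρ ℓ) ⟩
      (ρ * ℓ) * conj ℓ + (conj ρ * conj ℓ) * ℓ - k * (ℓ * conj ℓ)
                                                    ≡⟨ solve 5 (λ ρ ρ̄ ℓ ℓ̄ k → (ρ :* ℓ) :* ℓ̄ :+ (ρ̄ :* ℓ̄) :* ℓ :- k :* (ℓ :* ℓ̄) := (ℓ :* ℓ̄) :* (ρ :+ ρ̄ :- k))
                                                         refl ρ (conj ρ) ℓ (conj ℓ) k ⟩
      (ℓ * conj ℓ) * (trace ρ - k)                  ∎
      where
      ℓ = dot L x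
      φ = dot Φ x
      ρ = φ / ℓ

    Q≡0⇒trace≡k : ∀ k {x} → SubVec x → dot L x ≢ 0# → Q k x ≡ 0# → trace (dot Φ x / dot L x) ≡ k
    Q≡0⇒trace≡k k {x} x∈ ℓ≢0 Q≡0 =
      x-y≡0⇒x≡y (x*y≡0⇒y≡0 (*-≢0 ℓ≢0 (conj-≢0 ℓ≢0)) (trans (sym (Q-Sub k x∈ ℓ≢0)) Q≡0))

    trace≡k⇒Q≡0 : ∀ k {x} → SubVec x → dot L x ≢ 0# → trace (dot Φ x / dot L x) ≡ k → Q k x ≡ 0#
    trace≡k⇒Q≡0 k {x} x∈ ℓ≢0 trace≡k = begin
      Q k x                                                   ≡⟨ Q-Sub k x∈ ℓ≢0 ⟩
      (dot L x * conj (dot L x)) * (trace (dot Φ x / dot L x) - k) ≡⟨ cong (λ y → (dot L x * conj (dot L x)) * (y - k)) trace≡k ⟩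
      (dot L x * conj (dot L x)) * (k - k)                    ≡⟨ cong ((dot L x * conj (dot L x)) *_) (-‿inverseʳ k) ⟩
      (dot L x * conj (dot L x)) * 0#                         ≡⟨ zeroʳ _ ⟩
      0#                                                      ∎

    slope-embed : ∀ {c x} → c ≢ 0# → dot L x ≢ 0# → slope (c · embed B x) ≡ dot Φ x / dot L x
    slope-embed {c} {x} c≢0 ℓ≢0 = x≡z*y⇒x/y≡z (*-≢0 c≢0 (ℓ≢0 ∘ trans (sym (zc-embed x)))) (begin
      dot ℓP (c · embed B x)                       ≡⟨ dot-· ℓP c (embed B x) ⟩
      c * dot ℓP (embed B x)                       ≡⟨ cong (c *_) (trans (ℓP-embed x) (sym (/-*-cancel ℓ≢0))) ⟩
      c * ((dot Φ x / dot L x) * dot L x)          ≡⟨ solve 3 (λ c r l → c :* (r :* l) := r :* (c :* l)) refl c (dot Φ x / dot L x) (dot L x) ⟩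
      (dot Φ x / dot L x) * (c * dot L x)          ≡⟨ cong (λ l → (dot Φ x / dot L x) * (c * l)) (zc-embed x) ⟨
      (dot Φ x / dot L x) * (c * zc (embed B x))   ∎)

    disc : Carrier → Carrier
    disc k = discriminant (diagonal k Φ₁ L₁) (diagonal k Φ₂ L₂) (diagonal k Φ₃ L₃)
                          (offDiagonal k Φ₂ L₃ Φ₃ L₂) (offDiagonal k Φ₃ L₁ Φ₁ L₃) (offDiagonal k Φ₁ L₂ Φ₂ L₁)

    -- The k³ term vanishes as (L·x)(M·x) is degenerate, the k² term as L and M both vanish at L × M.
    disc-linear : ∀ k → disc k ≡ disc 0# - k * (X * det3 L M G)
    disc-linear k =
      solve 13 (λ l₁ l₂ l₃ m₁ m₂ m₃ φ₁ φ₂ φ₃ g₁ g₂ g₃ k →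
        let tr₂ₚ = λ φ g l m → φ :* m :+ g :* l
            diag = λ k φ g l m → tr₂ₚ φ g l m :- k :* (l :* m)
            off = λ k φ g l m φ′ g′ l′ m′ → (tr₂ₚ φ g l m :+ tr₂ₚ φ′ g′ l′ m′) :- k :* tr₂ₚ l′ m′ l m
            discₚ = λ a b c f g h → (1ₚ :+ 1ₚ :+ 1ₚ :+ 1ₚ) :* a :* b :* c :+ :- (a :* (f :* f)) :+ :- (b :* (g :* g))
                                      :+ :- (c :* (h :* h)) :+ f :* g :* h
            disc′ = λ k → discₚ (diag k φ₁ g₁ l₁ m₁) (diag k φ₂ g₂ l₂ m₂) (diag k φ₃ g₃ l₃ m₃)
                                (off k φ₂ g₂ l₃ m₃ φ₃ g₃ l₂ m₂) (off k φ₃ g₃ l₁ m₁ φ₁ g₁ l₃ m₃) (off k φ₁ g₁ l₂ m₂ φ₂ g₂ l₁ m₁)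
            L = l₁ , l₂ , l₃ ; M = m₁ , m₂ , m₃
        in disc′ k := disc′ 0ₚ :- k :* (det3ₚ L M (φ₁ , φ₂ , φ₃) :* det3ₚ L M (g₁ , g₂ , g₃)))
        refl L₁ L₂ L₃ (conj L₁) (conj L₂) (conj L₃) Φ₁ Φ₂ Φ₃ (conj Φ₁) (conj Φ₂) (conj Φ₃) k

    XY : Carrier
    XY = X * det3 L M G

    XY≡-N : XY ≡ - (X * conj X)
    XY≡-N = begin
      X * det3 L M G               ≡⟨ cong (X *_) (-‿involutive _) ⟨
      X * - - det3 L M G           ≡⟨ cong (λ y → X * - y) (det3-swap₁₂ L M G) ⟨
      X * - det3 M L G             ≡⟨ cong (λ y → X * - det3 M y G) (conjV-involutive L) ⟨
      X * - det3 M (conjV M) G     ≡⟨ cong (λ y → X * - y) (conj-det3 L M Φ) ⟨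
      X * - conj X                 ≡⟨ -‿distribʳ-* X (conj X) ⟨
      - (X * conj X)               ∎

    XY≢0 : XY ≢ 0#
    XY≢0 XY≡0 = *-≢0 X≢0 (conj-≢0 X≢0) (trans (sym (-‿involutive _)) (trans (cong -_ (sym XY≡-N)) (trans (cong -_ XY≡0) -0#≈0#)))

    XY∈ : InSub XY
    XY∈ = subst InSub (sym XY≡-N) (InSub-‿ (InSub-norm X))

    k⋆ : Carrier
    k⋆ = disc 0# / XY

    k⋆∈ : InSub k⋆
    k⋆∈ = InSub-/ (InSub-discriminant (ConicB.coeffsSub (conic 0# InSub-0))) XY∈

    degenerate⇒≡k⋆ : ∀ {k} k∈ → Degenerate (conic k k∈) → k ≡ k⋆
    degenerate⇒≡k⋆ {k} _ disc≡0 = sym (x≡z*y⇒x/y≡z XY≢0 (x-y≡0⇒x≡y (trans (sym (disc-linear k)) disc≡0)))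

    k⋆-degenerate : ∀ {k} k∈ → k ≡ k⋆ → Degenerate (conic k k∈)
    k⋆-degenerate {k} _ k≡k⋆ = begin
      disc k                      ≡⟨ disc-linear k ⟩
      disc 0# - k * XY            ≡⟨ cong (λ y → disc 0# - y * XY) k≡k⋆ ⟩
      disc 0# - k⋆ * XY           ≡⟨ cong (λ y → disc 0# - y) (/-*-cancel XY≢0) ⟩
      disc 0# - disc 0#           ≡⟨ -‿inverseʳ (disc 0#) ⟩
      0#                          ∎

    open Enumeration (Coordinates.subfield (proj₂ some-coordinate-∉))
      renaming (elem to k; elem-valid to k∈; elem-injective to k-injective; elem-onto to k-onto)

    π : Fin q → LinfBaerPencil P
    π i = pencil (k i)

    C : Fin q → ConicB
    C i = conic (k i) (k∈ i)

    partition : ∀ Y → Affine Y → Σ (Fin q) λ i → InPencil (π i) Y × (∀ j → InPencil (π j) Y → j ≡ i)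
    partition Y (_ , Y₃≢0) = i , trace⇒in-pencil (k∈ i) Y₃≢0 (sym kᵢ≡trace) , λ j Y∈πⱼ →
      k-injective (trans (sym (in-pencil⇒trace (k∈ j) Y₃≢0 Y∈πⱼ)) (sym kᵢ≡trace))
      where
      i = proj₁ (k-onto (InSub-trace (slope Y)))
      kᵢ≡trace = proj₂ (k-onto (InSub-trace (slope Y)))

    private
      slope-of-B-point : ∀ {Y x} → Same Y (embed B x) → zc Y ≢ 0# → dot L x ≢ 0# × slope Y ≡ dot Φ x / dot L x
      slope-of-B-point {Y} {x} (c , c≢0 , Y≡) Y₃≢0 = ℓ≢0 , trans (cong slope Y≡) (slope-embed c≢0 ℓ≢0)
        where
        ℓ≢0 : dot L x ≢ 0#
        ℓ≢0 ℓ≡0 = Y₃≢0 (trans (cong zc Y≡) (trans (cong (c *_) (trans (zc-embed x) ℓ≡0)) (zeroʳ c)))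

    B∩pencil⇒conic : ∀ i Y → Affine Y → InB B Y × InPencil (π i) Y → InConic B (C i) Y
    B∩pencil⇒conic i Y (_ , Y₃≢0) ((x , x∈ , x≢0 , Y∼x) , Y∈πᵢ) =
      x , x∈ , x≢0 ,
      trans (evalQ-conic (k i) (k∈ i) x)
            (trace≡k⇒Q≡0 (k i) x∈ ℓ≢0 (trans (cong trace (sym slope≡)) (in-pencil⇒trace (k∈ i) Y₃≢0 Y∈πᵢ))) ,
      Y∼x
      where
      ℓ≢0 = proj₁ (slope-of-B-point Y∼x Y₃≢0)
      slope≡ = proj₂ (slope-of-B-point Y∼x Y₃≢0)

    conic⇒B∩pencil : ∀ i Y → Affine Y → InConic B (C i) Y → InB B Y × InPencil (π i) Y
    conic⇒B∩pencil i Y (_ , Y₃≢0) (x , x∈ , x≢0 , Q≡0 , Y∼x) =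
      (x , x∈ , x≢0 , Y∼x) ,
      trace⇒in-pencil (k∈ i) Y₃≢0
        (trans (cong trace slope≡) (Q≡0⇒trace≡k (k i) x∈ ℓ≢0 (trans (sym (evalQ-conic (k i) (k∈ i) x)) Q≡0)))
      where
      ℓ≢0 = proj₁ (slope-of-B-point Y∼x Y₃≢0)
      slope≡ = proj₂ (slope-of-B-point Y∼x Y₃≢0)

    T-on-conics : ∀ i → InConic B (C i) T
    T-on-conics i = t , t-Sub , t≢0 , trans (evalQ-conic (k i) (k∈ i) t) (Q-t (k i)) , T∼t

    unique-degenerate : Σ (Fin q) λ i → Degenerate (C i) × (∀ j → ¬ j ≡ i → ¬ Degenerate (C j))
    unique-degenerate = i , k⋆-degenerate (k∈ i) kᵢ≡k⋆ , λ j j≢i Cⱼ-degenerate →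
      j≢i (k-injective (trans (degenerate⇒≡k⋆ (k∈ j) Cⱼ-degenerate) (sym kᵢ≡k⋆)))
      where
      i = proj₁ (k-onto k⋆∈)
      kᵢ≡k⋆ = proj₂ (k-onto k⋆∈)

    P-on-extensions : ∀ i → ExtContains B (C i) P
    P-on-extensions i = p , p≢0 , trans (evalQ-conic (k i) (k∈ i) p) (Q-p (k i)) , P∼p

-- The construction does not use the line l of B through T.
corollary2p14 : (q : ℕ) → IsPrimePower q → (F : FiniteField (q ^ 2)) →
    let open PG q F in
    (B : BaerSubplane) (T : V3) → TangentAt B T →
    (l : V3) → LineOfBThrough B l T →
    (P : V3) → NonZero3 P → OnLinf P → ¬ Same P T →
    Σ (Fin q → LinfBaerPencil P) λ π →
    Σ (Fin q → ConicB) λ C →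
      (∀ Y → Affine Y → Σ (Fin q) λ i → InPencil (π i) Y × (∀ j → InPencil (π j) Y → j ≡ i))
      × (∀ i Y → Affine Y →
           ((InB B Y × InPencil (π i) Y) → InConic B (C i) Y)
           × (InConic B (C i) Y → InB B Y × InPencil (π i) Y))
      × (∀ i → InConic B (C i) T)
      × (Σ (Fin q) λ i → Degenerate (C i) × (∀ j → ¬ j ≡ i → ¬ Degenerate (C j)))
      × (∀ i → ExtContains B (C i) P)
corollary2p14 q q-pp F B T tangent _ _ (P₁ , P₂ , _) P≢0 refl P≁T =
  π , C , partition , (λ i Y Y-affine → B∩pencil⇒conic i Y Y-affine , conic⇒B∩pencil i Y Y-affine) ,
  T-on-conics , unique-degenerate , P-on-extensions
  where
  open Plane.Configuration q q-pp F B T tangent P₁ P₂ P≢0 P≁T
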